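{- Let $\mathcal C$ be a set of frame conditions. Every rule of $\mathsf{N}\mathsf{Q}^{\circ}_{=}.\mathsf{K}(\mathcal{C})$ is height-preserving invertible: for every instance of a rule with premises $\mathcal P_1,\dots,\mathcal P_n$ and conclusion $\mathcal Q$, and every $1\le i\le n$, if $\mathcal Q$ has a proof of height $h$ then $\mathcal P_i$ has a proof of height at most $h$.
   Context: The height of a proof is the length of a maximal branch. Syntax. Terms are variables or constants. Formulas (negation normal form): $\phi ::= P(\vec t)\mid \neg P(\vec t)\mid t=s\mid t\neq s\mid \phi\lor\phi\mid\phi\land\phi\mid\exists x\phi\mid\forall x\phi\mid\Diamond\phi\mid\Box\phi$ ($P$ an $n$-ary predicate, $n\ge 0$). A literal is $P(\vec t)$, $\neg P(\vec t)$, $t=s$ or $t\neq s$; a negative literal is $\neg P(\vec t)$ or $t\neq s$. The negation $\overline{\phi}$ swaps $P(\vec t)/\neg P(\vec t)$, $=/\neq$, $\lor/\land$, $\exists/\forall$, $\Diamond/\Box$ (De Morgan duals). $\phi(t/x)$ is capture-avoiding substitution for free occurrences; formulas differing only in bound variable names are identified. Frames. A frame is $\langle W,R,U,D\rangle$ with $W\neq\emptyset$, $R\subseteq W\times W$, $U\neq\emptyset$ and $D_w\subseteq U$ for each $w\in W$. Frame conditions: $\mathbf D$: every $w$ has some $u$ with $wRu$; $\mathbf G(n,k)$ ($n,k\in\mathbb N$): $wR^nu$ and $wR^kv$ imply $uRv$ ($R^0$ = identity); $\mathbf{ID}$: $wRv\Rightarrow D_w\subseteq D_v$; $\mathbf{DD}$: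 $wRv\Rightarrow D_v\subseteq D_w$; $\mathbf{CD}$: $D_w=U$ for all $w$; $\mathbf{NE}$: $D_w\neq\emptyset$ for all $w$. $\mathcal C$ is a set of such conditions, assumed closed: if one of these conditions holds on every frame satisfying all of $\mathcal C$, it belongs to $\mathcal C$. $\mathbf G$ denotes the set of all $\mathbf G(n,k)\in\mathcal C$. Grammars. Characters $\mathsf f$, $\mathsf b$. A $\Sigma$-system $S$ is a set of productions $c\to s$, $c\in\{\mathsf f,\mathsf b\}$, $s$ a string over $\{\mathsf f,\mathsf b\}$; $s'cr'\to s'sr'$ is a one-step derivation, $\to^*_S$ its reflexive-transitive closure, $L_S(s)=\{t: s\to^*_S t\}$. $S(\mathbf G)$ contains $\mathsf f\to\mathsf b^n\mathsf f^k$ and $\mathsf b\to\mathsf b^k\mathsf f^n$ for each $\mathbf G(n,k)\in\mathbf G$; $S4=\{\mathsf f\to\varepsilon,\mathsf b\to\varepsilon,\mathsf f\to\mathsf f\mathsf f,\mathsf b\to\mathsf b\mathsf b\}$; $S5=\{\mathsf f\to\varepsilon,\mathsf b\to\varepsilon,\mathsf f\to\mathsf b\mathsf f,\mathsf b\to\mathsf b\mathsf f\}$. Nested sequents. A flat sequent is $\vec t,\vec\phi$: a finite multiset $\vec t$ of terms (signature) and a finite multiset $\vec\phi$ of formulas. A nested sequent is $\Gamma,[\mathcal H_1],\dots,[\mathcal H_n]$ ($n\ge 0$) with $\Gamma$ flat and $\mathcal H_i$ nested sequents; it is a tree of flat sequents (components), each with a unique name, $\Gamma$ being the root and the roots of the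 $\mathcal H_i$ its children. A context $\mathcal G\{\}$ has a hole in a component; $\mathcal G\{\mathcal H\}$ fills it, $\mathcal G\{\emptyset\}$ removes it; $\mathcal G\{\cdot\}_{w}\{\cdot\}_{u}$ indicates holes in the components named $w,u$. Propagation: for each parent $w$ and child $u$ we have $w\xrightarrow{\mathsf f}u$ and $u\xrightarrow{\mathsf b}w$; $w\xrightarrow{c_1\cdots c_m}u$ means there are components $w=v_0,\dots,v_m=u$ with $v_{i-1}\xrightarrow{c_i}v_i$ ($w=u$ for the empty string); $w\xrightarrow{L}u$ means $w\xrightarrow{s}u$ for some $s\in L$. Calculus. Rules (premises $\Rightarrow$ conclusion): (ax) $\Rightarrow\mathcal G\{L,\overline L\}$, $L$ a literal; ($\lor$) $\mathcal G\{\phi,\psi\}\Rightarrow\mathcal G\{\phi\lor\psi\}$; ($\land$) $\mathcal G\{\phi\}$, $\mathcal G\{\psi\}\Rightarrow\mathcal G\{\phi\land\psi\}$; ($\exists$) $\mathcal G\{t,\exists x\psi,\psi(t/x)\}\Rightarrow\mathcal G\{t,\exists x\psi\}$; ($\forall$) $\mathcal G\{y,\phi(y/x)\}\Rightarrow\mathcal G\{\forall x\phi\}$, $y$ a variable not free in the conclusion; ($\Diamond$) $\mathcal G\{\Diamond\phi\}_w\{\phi\}_u\Rightarrow\mathcal G\{\Diamond\phi\}_w\{\emptyset\}_u$ provided $w\xrightarrow{L}u$, $L=L_{S(\mathbf G)}(\mathsf f)$; ($\Box$) $\mathcal G\{[\phi]\}\Rightarrow\mathcal G\{\Box\phi\}$;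 (ref) $\mathcal G\{t\neq t\}\Rightarrow\mathcal G\{\emptyset\}$; (rep) $\mathcal G\{t\neq s,N(t/z),N(s/z)\}\Rightarrow\mathcal G\{t\neq s,N(t/z)\}$, $N$ a negative literal; (drep) $\mathcal G\{s,t,t\neq s\}\Rightarrow\mathcal G\{t,t\neq s\}$; (rig) $\mathcal G\{s\neq t\}_w\{s\neq t\}_u\Rightarrow\mathcal G\{s\neq t\}_w\{\emptyset\}_u$, $w\neq u$; (dp) $\mathcal G\{t\}_w\{t\}_u\Rightarrow\mathcal G\{t\}_w\{\emptyset\}_u$, $w\neq u$, $w\xrightarrow{L}u$ with $L=L_{S4\cup S(\mathbf G)}(\mathsf f)$ if $\mathbf{ID}\in\mathcal C,\mathbf{DD}\notin\mathcal C$, $L=L_{S4\cup S(\mathbf G)}(\mathsf b)$ if $\mathbf{DD}\in\mathcal C,\mathbf{ID}\notin\mathcal C$, $L=L_{S5}(\mathsf f)$ if both; (d) $\mathcal G\{[\emptyset]\}\Rightarrow\mathcal G\{\emptyset\}$; (nd) $\mathcal G\{y\}\Rightarrow\mathcal G\{\emptyset\}$, $y$ a variable not free in the conclusion; (cd) $\mathcal G\{t\}\Rightarrow\mathcal G\{\emptyset\}$. $\mathsf N\mathsf Q^\circ_=.\mathsf K(\mathcal C)$ consists of ax, $\lor$, $\land$, $\exists$, $\forall$, $\Diamond$, $\Box$, ref, rep, drep, rig, plus dp iff $\mathcal C\cap\{\mathbf{ID},\mathbf{DD}\}\neq\emptyset$, nd iff $\mathbf{NE}\in\mathcal C$, cd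 iff $\mathbf{CD}\in\mathcal C$, d iff $\mathbf D\in\mathcal C$. A proof is a finite tree of nested sequents whose nodes are conclusions of rule instances with their children as premises and whose leaves are ax instances. -}

module Defs where

open import Data.Nat using (ℕ; zero; suc; _⊔_; _≡ᵇ_)
open import Data.Bool using (if_then_else_)
open import Data.Fin using (Fin; zero; suc)
open import Data.Vec as Vec using (Vec)
open import Data.List using (List; []; _∷_; _++_; [_]; length; concatMap; replicate)
open import Data.List.Membership.Propositional using (_∈_)
open import Data.List.Relation.Binary.Permutation.Propositional using (_↭_)
open import Data.Product using (Σ; _×_; _,_)
open import Data.Sum using (_⊎_)
open import Relation.Nullary using (¬_)
open import Relation.Binary.PropositionalEquality using (_≡_; _≢_)
open import Relation.Binary.Construct.Closure.ReflexiveTransitive using (Star)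

-- Bound variables are de Bruijn *levels* (Fin n, level 0 is the
-- outermost binder in scope), free variables and constants are named by ℕ.
-- This realises "formulas differing only in bound variable names are
-- identified" and makes substitution capture-avoiding by construction.

data Term (n : ℕ) : Set where
  bv  : Fin n → Term n
  var : ℕ → Term n
  con : ℕ → Term n

-- closed terms: the terms of the paper (variables or constants)
Tm : Set
Tm = Term 0

-- formulas in negation normal form; a predicate symbol is (name, arity)
data Formula (n : ℕ) : Set where
  pos  : (P k : ℕ) → Vec (Term n) k → Formula n
  neg  : (P k : ℕ) → Vec (Term n) k → Formula n
  eq   : Term n → Term n → Formula n
  neq  : Term n → Term n → Formula n
  or   : Formula n → Formula n → Formula n
  and  : Formula n → Formula n → Formula n
  ex   : Formula (suc n) → Formula n
  all  : Formula (suc n) → Formula n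
  dia  : Formula n → Formula n
  box  : Formula n → Formula n

Fm : Set
Fm = Formula 0

‾ : ∀ {n} → Formula n → Formula n
‾ (pos P k ts) = neg P k ts
‾ (neg P k ts) = pos P k ts
‾ (eq t s) = neq t s
‾ (neq t s) = eq t s
‾ (or φ ψ) = and (‾ φ) (‾ ψ)
‾ (and φ ψ) = or (‾ φ) (‾ ψ)
‾ (ex φ) = all (‾ φ)
‾ (all φ) = ex (‾ φ)
‾ (dia φ) = box (‾ φ)
‾ (box φ) = dia (‾ φ)

data IsLiteral : Fm → Set where
  lit-pos : ∀ {P k ts} → IsLiteral (pos P k ts)
  lit-neg : ∀ {P k ts} → IsLiteral (neg P k ts)
  lit-eq  : ∀ {t s} → IsLiteral (eq t s)
  lit-neq : ∀ {t s} → IsLiteral (neq t s)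

data IsNegLiteral : Fm → Set where
  nlit-neg : ∀ {P k ts} → IsNegLiteral (neg P k ts)
  nlit-neq : ∀ {t s} → IsNegLiteral (neq t s)

wk : ∀ {n} → Tm → Term n
wk (var x) = var x
wk (con c) = con c

-- φ(t/x) where x is the outermost bound variable (level 0)
instT : ∀ {n} → Tm → Term (suc n) → Term n
instT t (bv zero) = wk t
instT t (bv (suc i)) = bv i
instT t (var x) = var x
instT t (con c) = con c

instF : ∀ {n} → Tm → Formula (suc n) → Formula n
instF t (pos P k ts) = pos P k (Vec.map (instT t) ts)
instF t (neg P k ts) = neg P k (Vec.map (instT t) ts)
instF t (eq a b) = eq (instT t a) (instT t b)
instF t (neq a b) = neq (instT t a) (instT t b)
instF t (or φ ψ) = or (instF t φ) (instF t ψ)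
instF t (and φ ψ) = and (instF t φ) (instF t ψ)
instF t (ex φ) = ex (instF t φ)
instF t (all φ) = all (instF t φ)
instF t (dia φ) = dia (instF t φ)
instF t (box φ) = box (instF t φ)

substT : ∀ {n} → ℕ → Tm → Term n → Term n
substT z t (bv i) = bv i
substT z t (var x) = if x ≡ᵇ z then wk t else var x
substT z t (con c) = con c

substF : ∀ {n} → ℕ → Tm → Formula n → Formula n
substF z t (pos P k ts) = pos P k (Vec.map (substT z t) ts)
substF z t (neg P k ts) = neg P k (Vec.map (substT z t) ts)
substF z t (eq a b) = eq (substT z t a) (substT z t b)
substF z t (neq a b) = neq (substT z t a) (substT z t b)
substF z t (or φ ψ) = or (substF z t φ) (substF z t ψ)
substF z t (and φ ψ) = and (substF z t φ) (substF z t ψ)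
substF z t (ex φ) = ex (substF z t φ)
substF z t (all φ) = all (substF z t φ)
substF z t (dia φ) = dia (substF z t φ)
substF z t (box φ) = box (substF z t φ)

fvT : ∀ {n} → Term n → List ℕ
fvT (bv i) = []
fvT (var x) = [ x ]
fvT (con c) = []

fvF : ∀ {n} → Formula n → List ℕ
fvF (pos P k ts) = concatMap fvT (Vec.toList ts)
fvF (neg P k ts) = concatMap fvT (Vec.toList ts)
fvF (eq a b) = fvT a ++ fvT b
fvF (neq a b) = fvT a ++ fvT b
fvF (or φ ψ) = fvF φ ++ fvF ψ
fvF (and φ ψ) = fvF φ ++ fvF ψ
fvF (ex φ) = fvF φ
fvF (all φ) = fvF φ
fvF (dia φ) = fvF φ
fvF (box φ) = fvF φ

data Cond : Set where
  D  : Cond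
  G  : ℕ → ℕ → Cond
  ID : Cond
  DD : Cond
  CD : Cond
  NE : Cond

record Frame : Set₁ where
  field
    W   : Set
    R   : W → W → Set
    U   : Set
    Dom : W → U → Set      -- D_w ⊆ U, as a predicate on U
    w₀  : W                -- W ≠ ∅
    u₀  : U                -- U ≠ ∅

module _ (F : Frame) where
  open Frame F

  Rpow : ℕ → W → W → Set
  Rpow zero w u = w ≡ u
  Rpow (suc n) w u = Σ W λ v → R w v × Rpow n v u

  Holds : Cond → Set
  Holds D = ∀ w → Σ W λ u → R w u
  Holds (G n k) = ∀ w u v → Rpow n w u → Rpow k w v → R u v
  Holds ID = ∀ w v → R w v → ∀ a → Dom w a → Dom v a
  Holds DD = ∀ w v → R w v → ∀ a → Dom v a → Dom w a
  Holds CD = ∀ w a → Dom w a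
  Holds NE = ∀ w → Σ U λ a → Dom w a

CondSet : Set₁
CondSet = Cond → Set

Closed : CondSet → Set₁
Closed 𝒞 = ∀ c → ((F : Frame) → (∀ c′ → 𝒞 c′ → Holds F c′) → Holds F c) → 𝒞 c

data Ch : Set where
  𝔣 𝔟 : Ch

System : Set₁
System = Ch → List Ch → Set

data SG (𝒞 : CondSet) : System where
  prod-f : ∀ {n k} → 𝒞 (G n k) → SG 𝒞 𝔣 (replicate n 𝔟 ++ replicate k 𝔣)
  prod-b : ∀ {n k} → 𝒞 (G n k) → SG 𝒞 𝔟 (replicate k 𝔟 ++ replicate n 𝔣)

data S4 : System where
  f-ε  : S4 𝔣 []
  b-ε  : S4 𝔟 []
  f-ff : S4 𝔣 (𝔣 ∷ 𝔣 ∷ [])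
  b-bb : S4 𝔟 (𝔟 ∷ 𝔟 ∷ [])

data S5 : System where
  f-ε  : S5 𝔣 []
  b-ε  : S5 𝔟 []
  f-bf : S5 𝔣 (𝔟 ∷ 𝔣 ∷ [])
  b-bf : S5 𝔟 (𝔟 ∷ 𝔣 ∷ [])

_∪S_ : System → System → System
(S ∪S T) c s = S c s ⊎ T c s

data Step (S : System) : List Ch → List Ch → Set where
  step : ∀ {c s} l r → S c s → Step S (l ++ c ∷ r) (l ++ s ++ r)

Lang : System → Ch → List Ch → Set
Lang S c t = Star (Step S) [ c ] t

-- Nested sequents: a node is  (signature , formulas , children)

data NSeq : Set where
  node : List Tm → List Fm → List NSeq → NSeq

fvSeq  : NSeq → List ℕ
fvSeqs : List NSeq → List ℕ
fvSeq (node ts fs cs) = concatMap fvT ts ++ concatMap fvF fs ++ fvSeqs cs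
fvSeqs [] = []
fvSeqs (c ∷ cs) = fvSeq c ++ fvSeqs cs

-- multiset identification: permutation of signature, formulas and
-- children (children themselves up to ≈)
data _≈_ : NSeq → NSeq → Set
data _≋_ : List NSeq → List NSeq → Set
data _≈_ where
  ≈node : ∀ {ts ts′ fs fs′ cs cs′} → ts ↭ ts′ → fs ↭ fs′ → cs ≋ cs′ →
          node ts fs cs ≈ node ts′ fs′ cs′
data _≋_ where
  []  : [] ≋ []
  pick : ∀ {x y xs} l r → x ≈ y → xs ≋ (l ++ r) → (x ∷ xs) ≋ (l ++ y ∷ r)

-- component names: paths from the root (list of child indices)
Pos : Set
Pos = List ℕ

data IsPos : NSeq → Pos → Set where
  root  : ∀ {H} → IsPos H []
  child : ∀ {ts fs l c r p} → IsPos c p → IsPos (node ts fs (l ++ c ∷ r)) (length l ∷ p)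

-- Add H w 𝒢 𝒬 : 𝒬 is 𝒢 with the nested sequent H plugged into the
-- component w (root of H merged into w, children of H become children of w),
-- i.e. 𝒬 = 𝒢{H} with the hole at w (𝒢 = 𝒢{∅}).
data Add (H : NSeq) : Pos → NSeq → NSeq → Set where
  here  : ∀ {ts fs cs ts′ fs′ cs′} → H ≡ node ts′ fs′ cs′ →
          Add H [] (node ts fs cs) (node (ts ++ ts′) (fs ++ fs′) (cs ++ cs′))
  there : ∀ {ts fs l c c′ r p} → Add H p c c′ →
          Add H (length l ∷ p) (node ts fs (l ++ c ∷ r)) (node ts fs (l ++ c′ ∷ r))

Child : NSeq → Pos → Pos → Set
Child 𝒢 w u = Σ ℕ λ i → (u ≡ w ++ [ i ]) × IsPos 𝒢 u

data Path (𝒢 : NSeq) : List Ch → Pos → Pos → Set where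
  nil   : ∀ {w} → IsPos 𝒢 w → Path 𝒢 [] w w
  fwd   : ∀ {s w v u} → Child 𝒢 w v → Path 𝒢 s v u → Path 𝒢 (𝔣 ∷ s) w u
  bwd   : ∀ {s w v u} → Child 𝒢 v w → Path 𝒢 s v u → Path 𝒢 (𝔟 ∷ s) w u

PathL : NSeq → (List Ch → Set) → Pos → Pos → Set
PathL 𝒢 L w u = Σ (List Ch) λ s → L s × Path 𝒢 s w u

fm : Fm → NSeq
fm φ = node [] [ φ ] []

fm2 : Fm → Fm → NSeq
fm2 φ ψ = node [] (φ ∷ ψ ∷ []) []

tm : Tm → NSeq
tm t = node [ t ] [] []

data Inst (𝒞 : CondSet) : List NSeq → NSeq → Set where
  ax   : ∀ {L w 𝒢 𝒬} → IsLiteral L → Add (fm2 L (‾ L)) w 𝒢 𝒬 → Inst 𝒞 [] 𝒬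
  ∨r   : ∀ {φ ψ w 𝒢 𝒬 𝒫} → Add (fm (or φ ψ)) w 𝒢 𝒬 → Add (fm2 φ ψ) w 𝒢 𝒫 →
         Inst 𝒞 [ 𝒫 ] 𝒬
  ∧r   : ∀ {φ ψ w 𝒢 𝒬 𝒫₁ 𝒫₂} → Add (fm (and φ ψ)) w 𝒢 𝒬 →
         Add (fm φ) w 𝒢 𝒫₁ → Add (fm ψ) w 𝒢 𝒫₂ → Inst 𝒞 (𝒫₁ ∷ 𝒫₂ ∷ []) 𝒬
  ∃r   : ∀ {t ψ w 𝒢 𝒬 𝒫} → Add (node [ t ] [ ex ψ ] []) w 𝒢 𝒬 →
         Add (fm (instF t ψ)) w 𝒬 𝒫 → Inst 𝒞 [ 𝒫 ] 𝒬
  ∀r   : ∀ {φ y w 𝒢 𝒬 𝒫} → Add (fm (all φ)) w 𝒢 𝒬 →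
         Add (node [ var y ] [ instF (var y) φ ] []) w 𝒢 𝒫 →
         ¬ (y ∈ fvSeq 𝒬) → Inst 𝒞 [ 𝒫 ] 𝒬
  ◇r   : ∀ {φ w u 𝒢 𝒬 𝒫} → Add (fm (dia φ)) w 𝒢 𝒬 → Add (fm φ) u 𝒬 𝒫 →
         PathL 𝒬 (Lang (SG 𝒞) 𝔣) w u → Inst 𝒞 [ 𝒫 ] 𝒬
  □r   : ∀ {φ w 𝒢 𝒬 𝒫} → Add (fm (box φ)) w 𝒢 𝒬 →
         Add (node [] [] [ fm φ ]) w 𝒢 𝒫 → Inst 𝒞 [ 𝒫 ] 𝒬
  ref  : ∀ {t w 𝒬 𝒫} → Add (fm (neq t t)) w 𝒬 𝒫 → Inst 𝒞 [ 𝒫 ] 𝒬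
  rep  : ∀ {N z t s w 𝒢 𝒬 𝒫} → IsNegLiteral N →
         Add (fm2 (neq t s) (substF z t N)) w 𝒢 𝒬 →
         Add (fm (substF z s N)) w 𝒬 𝒫 → Inst 𝒞 [ 𝒫 ] 𝒬
  drep : ∀ {t s w 𝒢 𝒬 𝒫} → Add (node [ t ] [ neq t s ] []) w 𝒢 𝒬 →
         Add (tm s) w 𝒬 𝒫 → Inst 𝒞 [ 𝒫 ] 𝒬
  rig  : ∀ {s t w u 𝒢 𝒬 𝒫} → Add (fm (neq s t)) w 𝒢 𝒬 →
         Add (fm (neq s t)) u 𝒬 𝒫 → w ≢ u → Inst 𝒞 [ 𝒫 ] 𝒬
  dp-ID : ∀ {t w u 𝒢 𝒬 𝒫} → 𝒞 ID → ¬ 𝒞 DD →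
         Add (tm t) w 𝒢 𝒬 → Add (tm t) u 𝒬 𝒫 → w ≢ u →
         PathL 𝒬 (Lang (S4 ∪S SG 𝒞) 𝔣) w u → Inst 𝒞 [ 𝒫 ] 𝒬
  dp-DD : ∀ {t w u 𝒢 𝒬 𝒫} → 𝒞 DD → ¬ 𝒞 ID →
         Add (tm t) w 𝒢 𝒬 → Add (tm t) u 𝒬 𝒫 → w ≢ u →
         PathL 𝒬 (Lang (S4 ∪S SG 𝒞) 𝔟) w u → Inst 𝒞 [ 𝒫 ] 𝒬
  dp-both : ∀ {t w u 𝒢 𝒬 𝒫} → 𝒞 ID → 𝒞 DD →
         Add (tm t) w 𝒢 𝒬 → Add (tm t) u 𝒬 𝒫 → w ≢ u →
         PathL 𝒬 (Lang S5 𝔣) w u → Inst 𝒞 [ 𝒫 ] 𝒬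
  d    : ∀ {w 𝒬 𝒫} → 𝒞 D → Add (node [] [] [ node [] [] [] ]) w 𝒬 𝒫 →
         Inst 𝒞 [ 𝒫 ] 𝒬
  nd   : ∀ {y w 𝒬 𝒫} → 𝒞 NE → Add (tm (var y)) w 𝒬 𝒫 → ¬ (y ∈ fvSeq 𝒬) →
         Inst 𝒞 [ 𝒫 ] 𝒬
  cd   : ∀ {t w 𝒬 𝒫} → 𝒞 CD → Add (tm t) w 𝒬 𝒫 → Inst 𝒞 [ 𝒫 ] 𝒬

data Proof (𝒞 : CondSet) : NSeq → Set
data Proofs (𝒞 : CondSet) : List NSeq → Set
data Proof 𝒞 where
  by : ∀ {𝒬 𝒬′ Ps} → 𝒬 ≈ 𝒬′ → Inst 𝒞 Ps 𝒬′ → Proofs 𝒞 Ps → Proof 𝒞 𝒬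
data Proofs 𝒞 where
  []  : Proofs 𝒞 []
  _∷_ : ∀ {P Ps} → Proof 𝒞 P → Proofs 𝒞 Ps → Proofs 𝒞 (P ∷ Ps)

-- height = number of nodes on a maximal branch
height  : ∀ {𝒞 𝒬} → Proof 𝒞 𝒬 → ℕ
heights : ∀ {𝒞 Ps} → Proofs 𝒞 Ps → ℕ
height (by _ _ πs) = suc (heights πs)
heights [] = 0
heights (π ∷ πs) = height π ⊔ heights πs

-- Each premise of a rule instance arises from its conclusion by an expansion: terms, formulas and
-- components are added anywhere in the tree (weakening), and at most one occurrence of φ ∨ ψ, φ ∧ ψ,
-- ∀x φ or □φ is replaced by the material the rule puts in its premise (φ, ψ; φ or ψ; y, φ(y/x) with y
-- fresh; [φ]).  By induction on height, an expansion of a provable sequent is provable with no greater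
-- height: the last rule is replayed on the expanded sequent, whose propagation paths, distinct
-- positions and fresh variables survive the expansion, and the expansion is pushed into its premises;
-- if the principal formula is the replaced occurrence itself, the (expanded) premise of that rule
-- already is the sought sequent.  Eigenvariables of ∀ and nd that clash with the added material are
-- renamed by a transposition of variables, which maps proofs to proofs of the same height.

module Submission where

open import Defs
open import Data.Nat using (ℕ; zero; suc; _+_; _⊔_; _≤_; z≤n; s≤s; pred; _≡ᵇ_)
open import Data.Nat.Properties
  using ( _≟_; ≤-refl; ≤-trans; <-irrefl; m≤m⊔n; m≤n⊔m; m⊔n≤o⇒m≤o; m⊔n≤o⇒n≤o
        ; ⊔-mono-≤; ⊔-monoˡ-≤; n≤1+n; +-assoc; +-identityʳ)
open import Data.Nat.Tactic.RingSolver using (solve-∀)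
open import Data.Bool using (true; false)
open import Data.Fin using (zero; suc)
open import Data.Vec as Vec using (Vec)
open import Data.List using (List; []; _∷_; _++_; [_]; length; concatMap; map)
open import Data.List.Properties
  using (map-++; concatMap-++; ++-assoc; ++-identityʳ; ++-conicalˡ; ++-conicalʳ; ∷-injective)
open import Data.List.Extrema.Nat using (max; xs≤max)
open import Data.List.Membership.Propositional using (_∈_)
open import Data.List.Membership.Propositional.Properties using (∈-map⁻; ∈-++⁺ˡ; ∈-++⁺ʳ; ∈-∃++)
open import Data.List.Relation.Unary.Any using (here; there)
open import Data.List.Relation.Unary.All as All using (All; []; _∷_)
open import Data.List.Relation.Binary.Pointwise using (Pointwise; []; _∷_)
import Data.List.Relation.Binary.Pointwise as Pointwise
open import Data.List.Relation.Binary.Permutation.Propositional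
  using (_↭_; refl; prep; swap; trans; ↭-sym; ↭-reflexive; ↭-refl)
open import Data.List.Relation.Binary.Permutation.Propositional.Properties
  using (map⁺; ∈-resp-↭; drop-mid; shift; shifts; ++⁺; ++⁺ˡ; ++⁺ʳ; ↭-empty-inv; ++-commutativeMonoid)
import Algebra.Solver.CommutativeMonoid as CommutativeMonoidSolver
open import Data.Product using (Σ; _×_; _,_)
open import Data.Sum using (_⊎_; inj₁; inj₂; map₂)
open import Data.Empty using (⊥-elim)
open import Function using (_∘_)
open import Function.Definitions using (Injective)
open import Relation.Nullary using (¬_; yes; no)
open import Relation.Nullary.Decidable using (dec-true; dec-false)
open import Relation.Binary.PropositionalEquality
  using (_≡_; _≢_; refl; sym; cong; cong₂; subst; subst₂; module ≡-Reasoning) renaming (trans to ≡-trans)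

-- Renaming free variables

renT : ∀ {n} → (ℕ → ℕ) → Term n → Term n
renT ρ (bv i) = bv i
renT ρ (var x) = var (ρ x)
renT ρ (con c) = con c

renF : ∀ {n} → (ℕ → ℕ) → Formula n → Formula n
renF ρ (pos P k ts) = pos P k (Vec.map (renT ρ) ts)
renF ρ (neg P k ts) = neg P k (Vec.map (renT ρ) ts)
renF ρ (eq a b) = eq (renT ρ a) (renT ρ b)
renF ρ (neq a b) = neq (renT ρ a) (renT ρ b)
renF ρ (or φ ψ) = or (renF ρ φ) (renF ρ ψ)
renF ρ (and φ ψ) = and (renF ρ φ) (renF ρ ψ)
renF ρ (ex φ) = ex (renF ρ φ)
renF ρ (all φ) = all (renF ρ φ)
renF ρ (dia φ) = dia (renF ρ φ)
renF ρ (box φ) = box (renF ρ φ)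

renSeq : (ℕ → ℕ) → NSeq → NSeq
renSeqs : (ℕ → ℕ) → List NSeq → List NSeq
renSeq ρ (node ts fs cs) = node (map (renT ρ) ts) (map (renF ρ) fs) (renSeqs ρ cs)
renSeqs ρ [] = []
renSeqs ρ (c ∷ cs) = renSeq ρ c ∷ renSeqs ρ cs

renT-wk : ∀ {n} ρ (t : Tm) → renT {n} ρ (wk t) ≡ wk (renT ρ t)
renT-wk ρ (var x) = refl
renT-wk ρ (con c) = refl

renT-instT : ∀ {n} ρ (t : Tm) (a : Term (suc n)) → renT ρ (instT t a) ≡ instT (renT ρ t) (renT ρ a)
renT-instT ρ t (bv zero) = renT-wk ρ t
renT-instT ρ t (bv (suc i)) = refl
renT-instT ρ t (var x) = refl
renT-instT ρ t (con c) = refl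

renTs-instT : ∀ {n k} ρ (t : Tm) (ts : Vec (Term (suc n)) k) →
  Vec.map (renT ρ) (Vec.map (instT t) ts) ≡ Vec.map (instT (renT ρ t)) (Vec.map (renT ρ) ts)
renTs-instT ρ t Vec.[] = refl
renTs-instT ρ t (a Vec.∷ ts) = cong₂ Vec._∷_ (renT-instT ρ t a) (renTs-instT ρ t ts)

renF-instF : ∀ {n} ρ (t : Tm) (φ : Formula (suc n)) → renF ρ (instF t φ) ≡ instF (renT ρ t) (renF ρ φ)
renF-instF ρ t (pos P k ts) = cong (pos P k) (renTs-instT ρ t ts)
renF-instF ρ t (neg P k ts) = cong (neg P k) (renTs-instT ρ t ts)
renF-instF ρ t (eq a b) = cong₂ eq (renT-instT ρ t a) (renT-instT ρ t b)
renF-instF ρ t (neq a b) = cong₂ neq (renT-instT ρ t a) (renT-instT ρ t b)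
renF-instF ρ t (or φ ψ) = cong₂ or (renF-instF ρ t φ) (renF-instF ρ t ψ)
renF-instF ρ t (and φ ψ) = cong₂ and (renF-instF ρ t φ) (renF-instF ρ t ψ)
renF-instF ρ t (ex φ) = cong ex (renF-instF ρ t φ)
renF-instF ρ t (all φ) = cong all (renF-instF ρ t φ)
renF-instF ρ t (dia φ) = cong dia (renF-instF ρ t φ)
renF-instF ρ t (box φ) = cong box (renF-instF ρ t φ)

renF-‾ : ∀ {n} ρ (φ : Formula n) → renF ρ (‾ φ) ≡ ‾ (renF ρ φ)
renF-‾ ρ (pos P k ts) = refl
renF-‾ ρ (neg P k ts) = refl
renF-‾ ρ (eq a b) = refl
renF-‾ ρ (neq a b) = refl
renF-‾ ρ (or φ ψ) = cong₂ and (renF-‾ ρ φ) (renF-‾ ρ ψ)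
renF-‾ ρ (and φ ψ) = cong₂ or (renF-‾ ρ φ) (renF-‾ ρ ψ)
renF-‾ ρ (ex φ) = cong all (renF-‾ ρ φ)
renF-‾ ρ (all φ) = cong ex (renF-‾ ρ φ)
renF-‾ ρ (dia φ) = cong box (renF-‾ ρ φ)
renF-‾ ρ (box φ) = cong dia (renF-‾ ρ φ)

renF-IsLiteral : ∀ ρ {L} → IsLiteral L → IsLiteral (renF ρ L)
renF-IsLiteral ρ lit-pos = lit-pos
renF-IsLiteral ρ lit-neg = lit-neg
renF-IsLiteral ρ lit-eq = lit-eq
renF-IsLiteral ρ lit-neq = lit-neq

renF-IsNegLiteral : ∀ ρ {L} → IsNegLiteral L → IsNegLiteral (renF ρ L)
renF-IsNegLiteral ρ nlit-neg = nlit-neg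
renF-IsNegLiteral ρ nlit-neq = nlit-neq

≡ᵇ-injective : ∀ {ρ} → Injective _≡_ _≡_ ρ → ∀ x z → (ρ x ≡ᵇ ρ z) ≡ (x ≡ᵇ z)
≡ᵇ-injective {ρ} ρ-inj x z with x ≟ z
... | yes refl = ≡-trans (dec-true (ρ x ≟ ρ x) refl) (sym (dec-true (x ≟ x) refl))
... | no x≢z = ≡-trans (dec-false (ρ x ≟ ρ z) (x≢z ∘ ρ-inj)) (sym (dec-false (x ≟ z) x≢z))

renT-substT : ∀ {n ρ} → Injective _≡_ _≡_ ρ → ∀ z (t : Tm) (a : Term n) →
  renT ρ (substT z t a) ≡ substT (ρ z) (renT ρ t) (renT ρ a)
renT-substT ρ-inj z t (bv i) = refl
renT-substT {ρ = ρ} ρ-inj z t (var x) rewrite ≡ᵇ-injective ρ-inj x z with x ≡ᵇ z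
... | true = renT-wk ρ t
... | false = refl
renT-substT ρ-inj z t (con c) = refl

renTs-substT : ∀ {n k ρ} → Injective _≡_ _≡_ ρ → ∀ z (t : Tm) (ts : Vec (Term n) k) →
  Vec.map (renT ρ) (Vec.map (substT z t) ts) ≡ Vec.map (substT (ρ z) (renT ρ t)) (Vec.map (renT ρ) ts)
renTs-substT ρ-inj z t Vec.[] = refl
renTs-substT ρ-inj z t (a Vec.∷ ts) = cong₂ Vec._∷_ (renT-substT ρ-inj z t a) (renTs-substT ρ-inj z t ts)

renF-substF : ∀ {n ρ} → Injective _≡_ _≡_ ρ → ∀ z (t : Tm) (φ : Formula n) →
  renF ρ (substF z t φ) ≡ substF (ρ z) (renT ρ t) (renF ρ φ)
renF-substF ρ-inj z t (pos P k ts) = cong (pos P k) (renTs-substT ρ-inj z t ts)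
renF-substF ρ-inj z t (neg P k ts) = cong (neg P k) (renTs-substT ρ-inj z t ts)
renF-substF ρ-inj z t (eq a b) = cong₂ eq (renT-substT ρ-inj z t a) (renT-substT ρ-inj z t b)
renF-substF ρ-inj z t (neq a b) = cong₂ neq (renT-substT ρ-inj z t a) (renT-substT ρ-inj z t b)
renF-substF ρ-inj z t (or φ ψ) = cong₂ or (renF-substF ρ-inj z t φ) (renF-substF ρ-inj z t ψ)
renF-substF ρ-inj z t (and φ ψ) = cong₂ and (renF-substF ρ-inj z t φ) (renF-substF ρ-inj z t ψ)
renF-substF ρ-inj z t (ex φ) = cong ex (renF-substF ρ-inj z t φ)
renF-substF ρ-inj z t (all φ) = cong all (renF-substF ρ-inj z t φ)
renF-substF ρ-inj z t (dia φ) = cong dia (renF-substF ρ-inj z t φ)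
renF-substF ρ-inj z t (box φ) = cong box (renF-substF ρ-inj z t φ)

fvT-renT : ∀ {n} ρ (a : Term n) → fvT (renT ρ a) ≡ map ρ (fvT a)
fvT-renT ρ (bv i) = refl
fvT-renT ρ (var x) = refl
fvT-renT ρ (con c) = refl

fvTs-renT : ∀ {n k} ρ (ts : Vec (Term n) k) →
  concatMap fvT (Vec.toList (Vec.map (renT ρ) ts)) ≡ map ρ (concatMap fvT (Vec.toList ts))
fvTs-renT ρ Vec.[] = refl
fvTs-renT ρ (a Vec.∷ ts) =
  ≡-trans (cong₂ _++_ (fvT-renT ρ a) (fvTs-renT ρ ts)) (sym (map-++ ρ (fvT a) _))

fvF-renF : ∀ {n} ρ (φ : Formula n) → fvF (renF ρ φ) ≡ map ρ (fvF φ)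
fvF-renF ρ (pos P k ts) = fvTs-renT ρ ts
fvF-renF ρ (neg P k ts) = fvTs-renT ρ ts
fvF-renF ρ (eq a b) = ≡-trans (cong₂ _++_ (fvT-renT ρ a) (fvT-renT ρ b)) (sym (map-++ ρ (fvT a) (fvT b)))
fvF-renF ρ (neq a b) = ≡-trans (cong₂ _++_ (fvT-renT ρ a) (fvT-renT ρ b)) (sym (map-++ ρ (fvT a) (fvT b)))
fvF-renF ρ (or φ ψ) = ≡-trans (cong₂ _++_ (fvF-renF ρ φ) (fvF-renF ρ ψ)) (sym (map-++ ρ (fvF φ) (fvF ψ)))
fvF-renF ρ (and φ ψ) = ≡-trans (cong₂ _++_ (fvF-renF ρ φ) (fvF-renF ρ ψ)) (sym (map-++ ρ (fvF φ) (fvF ψ)))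
fvF-renF ρ (ex φ) = fvF-renF ρ φ
fvF-renF ρ (all φ) = fvF-renF ρ φ
fvF-renF ρ (dia φ) = fvF-renF ρ φ
fvF-renF ρ (box φ) = fvF-renF ρ φ

concatMap-map-ren : ∀ {A : Set} (fv : A → List ℕ) (ren : A → A) ρ → (∀ a → fv (ren a) ≡ map ρ (fv a)) →
  ∀ xs → concatMap fv (map ren xs) ≡ map ρ (concatMap fv xs)
concatMap-map-ren fv ren ρ fv-ren [] = refl
concatMap-map-ren fv ren ρ fv-ren (a ∷ xs) =
  ≡-trans (cong₂ _++_ (fv-ren a) (concatMap-map-ren fv ren ρ fv-ren xs)) (sym (map-++ ρ (fv a) _))

fvSeq-renSeq : ∀ ρ A → fvSeq (renSeq ρ A) ≡ map ρ (fvSeq A)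
fvSeqs-renSeqs : ∀ ρ cs → fvSeqs (renSeqs ρ cs) ≡ map ρ (fvSeqs cs)
fvSeq-renSeq ρ (node ts fs cs) = begin
  concatMap fvT (map (renT ρ) ts) ++ concatMap fvF (map (renF ρ) fs) ++ fvSeqs (renSeqs ρ cs)
    ≡⟨ cong₂ _++_ (concatMap-map-ren fvT (renT ρ) ρ (fvT-renT ρ) ts)
                  (cong₂ _++_ (concatMap-map-ren fvF (renF ρ) ρ (fvF-renF ρ) fs) (fvSeqs-renSeqs ρ cs)) ⟩
  map ρ (concatMap fvT ts) ++ map ρ (concatMap fvF fs) ++ map ρ (fvSeqs cs)
    ≡⟨ cong (map ρ (concatMap fvT ts) ++_) (sym (map-++ ρ (concatMap fvF fs) (fvSeqs cs))) ⟩
  map ρ (concatMap fvT ts) ++ map ρ (concatMap fvF fs ++ fvSeqs cs)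
    ≡⟨ sym (map-++ ρ (concatMap fvT ts) _) ⟩
  map ρ (fvSeq (node ts fs cs)) ∎
  where open ≡-Reasoning
fvSeqs-renSeqs ρ [] = refl
fvSeqs-renSeqs ρ (c ∷ cs) =
  ≡-trans (cong₂ _++_ (fvSeq-renSeq ρ c) (fvSeqs-renSeqs ρ cs)) (sym (map-++ ρ (fvSeq c) (fvSeqs cs)))

∈-fvSeq-renSeq⁻ : ∀ {ρ x} A → x ∈ fvSeq (renSeq ρ A) → Σ ℕ λ z → z ∈ fvSeq A × x ≡ ρ z
∈-fvSeq-renSeq⁻ {ρ} {x} A x∈ = ∈-map⁻ ρ (subst (x ∈_) (fvSeq-renSeq ρ A) x∈)

renSeq-∉ : ∀ {ρ y} A → Injective _≡_ _≡_ ρ → ¬ (y ∈ fvSeq A) → ¬ (ρ y ∈ fvSeq (renSeq ρ A))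
renSeq-∉ A ρ-inj y∉ ρy∈ with ∈-fvSeq-renSeq⁻ A ρy∈
... | z , z∈ , ρy≡ρz = y∉ (subst (_∈ fvSeq A) (sym (ρ-inj ρy≡ρz)) z∈)

Fixes : (ℕ → ℕ) → List ℕ → Set
Fixes ρ xs = ∀ {x} → x ∈ xs → ρ x ≡ x

Fixes-++ˡ : ∀ {ρ} xs {ys} → Fixes ρ (xs ++ ys) → Fixes ρ xs
Fixes-++ˡ xs f x∈ = f (∈-++⁺ˡ x∈)

Fixes-++ʳ : ∀ {ρ} xs {ys} → Fixes ρ (xs ++ ys) → Fixes ρ ys
Fixes-++ʳ xs f x∈ = f (∈-++⁺ʳ xs x∈)

renT-id : ∀ {n ρ} (a : Term n) → Fixes ρ (fvT a) → renT ρ a ≡ a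
renT-id (bv i) f = refl
renT-id (var x) f = cong var (f (here refl))
renT-id (con c) f = refl

renTs-id : ∀ {n k ρ} (ts : Vec (Term n) k) → Fixes ρ (concatMap fvT (Vec.toList ts)) → Vec.map (renT ρ) ts ≡ ts
renTs-id Vec.[] f = refl
renTs-id (a Vec.∷ ts) f = cong₂ Vec._∷_ (renT-id a (Fixes-++ˡ (fvT a) f)) (renTs-id ts (Fixes-++ʳ (fvT a) f))

renF-id : ∀ {n ρ} (φ : Formula n) → Fixes ρ (fvF φ) → renF ρ φ ≡ φ
renF-id (pos P k ts) f = cong (pos P k) (renTs-id ts f)
renF-id (neg P k ts) f = cong (neg P k) (renTs-id ts f)
renF-id (eq a b) f = cong₂ eq (renT-id a (Fixes-++ˡ (fvT a) f)) (renT-id b (Fixes-++ʳ (fvT a) f))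
renF-id (neq a b) f = cong₂ neq (renT-id a (Fixes-++ˡ (fvT a) f)) (renT-id b (Fixes-++ʳ (fvT a) f))
renF-id (or φ ψ) f = cong₂ or (renF-id φ (Fixes-++ˡ (fvF φ) f)) (renF-id ψ (Fixes-++ʳ (fvF φ) f))
renF-id (and φ ψ) f = cong₂ and (renF-id φ (Fixes-++ˡ (fvF φ) f)) (renF-id ψ (Fixes-++ʳ (fvF φ) f))
renF-id (ex φ) f = cong ex (renF-id φ f)
renF-id (all φ) f = cong all (renF-id φ f)
renF-id (dia φ) f = cong dia (renF-id φ f)
renF-id (box φ) f = cong box (renF-id φ f)

map-ren-id : ∀ {A : Set} (fv : A → List ℕ) (ren : A → A) ρ → (∀ a → Fixes ρ (fv a) → ren a ≡ a) →
  ∀ xs → Fixes ρ (concatMap fv xs) → map ren xs ≡ xs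
map-ren-id fv ren ρ ren-id [] f = refl
map-ren-id fv ren ρ ren-id (a ∷ xs) f =
  cong₂ _∷_ (ren-id a (Fixes-++ˡ (fv a) f)) (map-ren-id fv ren ρ ren-id xs (Fixes-++ʳ (fv a) f))

renSeq-id : ∀ {ρ} A → Fixes ρ (fvSeq A) → renSeq ρ A ≡ A
renSeqs-id : ∀ {ρ} cs → Fixes ρ (fvSeqs cs) → renSeqs ρ cs ≡ cs
renSeq-id {ρ} (node ts fs cs) f
  rewrite map-ren-id fvT (renT ρ) ρ renT-id ts (Fixes-++ˡ (concatMap fvT ts) f)
        | map-ren-id fvF (renF ρ) ρ renF-id fs (Fixes-++ˡ (concatMap fvF fs) (Fixes-++ʳ (concatMap fvT ts) f))
        | renSeqs-id cs (Fixes-++ʳ (concatMap fvF fs) (Fixes-++ʳ (concatMap fvT ts) f)) = refl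
renSeqs-id [] f = refl
renSeqs-id (c ∷ cs) f = cong₂ _∷_ (renSeq-id c (Fixes-++ˡ (fvSeq c) f)) (renSeqs-id cs (Fixes-++ʳ (fvSeq c) f))

renSeqs-++ : ∀ ρ l r → renSeqs ρ (l ++ r) ≡ renSeqs ρ l ++ renSeqs ρ r
renSeqs-++ ρ [] r = refl
renSeqs-++ ρ (c ∷ l) r = cong (renSeq ρ c ∷_) (renSeqs-++ ρ l r)

length-renSeqs : ∀ ρ l → length (renSeqs ρ l) ≡ length l
length-renSeqs ρ [] = refl
length-renSeqs ρ (c ∷ l) = cong suc (length-renSeqs ρ l)

renSeq-Add : ∀ ρ {H w G Q} → Add H w G Q → Add (renSeq ρ H) w (renSeq ρ G) (renSeq ρ Q)
renSeq-Add ρ (here {ts} {fs} {cs} {ts′} {fs′} {cs′} refl)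
  rewrite map-++ (renT ρ) ts ts′ | map-++ (renF ρ) fs fs′ | renSeqs-++ ρ cs cs′ = here refl
renSeq-Add ρ (there {ts} {fs} {l} {c} {c′} {r} {p} a)
  rewrite renSeqs-++ ρ l (c ∷ r) | renSeqs-++ ρ l (c′ ∷ r) =
  subst (λ i → Add _ (i ∷ p) (node _ _ (renSeqs ρ l ++ renSeq ρ c ∷ renSeqs ρ r))
                             (node _ _ (renSeqs ρ l ++ renSeq ρ c′ ∷ renSeqs ρ r)))
        (length-renSeqs ρ l) (there (renSeq-Add ρ a))

renSeq-≈ : ∀ ρ {A B} → A ≈ B → renSeq ρ A ≈ renSeq ρ B
renSeqs-≋ : ∀ ρ {as bs} → as ≋ bs → renSeqs ρ as ≋ renSeqs ρ bs
renSeq-≈ ρ (≈node p q r) = ≈node (map⁺ (renT ρ) p) (map⁺ (renF ρ) q) (renSeqs-≋ ρ r)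
renSeqs-≋ ρ [] = []
renSeqs-≋ ρ (pick {y = y} {xs = xs} l r e p) rewrite renSeqs-++ ρ l (y ∷ r) =
  pick (renSeqs ρ l) (renSeqs ρ r) (renSeq-≈ ρ e) (subst (renSeqs ρ xs ≋_) (renSeqs-++ ρ l r) (renSeqs-≋ ρ p))

renSeq-IsPos : ∀ ρ {A p} → IsPos A p → IsPos (renSeq ρ A) p
renSeq-IsPos ρ root = root
renSeq-IsPos ρ (child {l = l} {c} {r} {p} h) rewrite renSeqs-++ ρ l (c ∷ r) =
  subst (λ i → IsPos (node _ _ (renSeqs ρ l ++ renSeq ρ c ∷ renSeqs ρ r)) (i ∷ p))
        (length-renSeqs ρ l) (child (renSeq-IsPos ρ h))

renSeq-Path : ∀ ρ {A s w u} → Path A s w u → Path (renSeq ρ A) s w u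
renSeq-Path ρ (nil x) = nil (renSeq-IsPos ρ x)
renSeq-Path ρ (fwd (i , e , x) p) = fwd (i , e , renSeq-IsPos ρ x) (renSeq-Path ρ p)
renSeq-Path ρ (bwd (i , e , x) p) = bwd (i , e , renSeq-IsPos ρ x) (renSeq-Path ρ p)

renSeq-PathL : ∀ ρ {A L w u} → PathL A L w u → PathL (renSeq ρ A) L w u
renSeq-PathL ρ (s , s∈L , p) = s , s∈L , renSeq-Path ρ p

renSeq-Inst : ∀ {𝒞 ρ} → Injective _≡_ _≡_ ρ → ∀ {Ps Q} → Inst 𝒞 Ps Q → Inst 𝒞 (map (renSeq ρ) Ps) (renSeq ρ Q)
renSeq-Inst {ρ = ρ} _ (ax {L} lit a) =
  ax (renF-IsLiteral ρ lit) (subst (λ L̄ → Add (fm2 (renF ρ L) L̄) _ _ _) (renF-‾ ρ L) (renSeq-Add ρ a))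
renSeq-Inst {ρ = ρ} _ (∨r a b) = ∨r (renSeq-Add ρ a) (renSeq-Add ρ b)
renSeq-Inst {ρ = ρ} _ (∧r a b c) = ∧r (renSeq-Add ρ a) (renSeq-Add ρ b) (renSeq-Add ρ c)
renSeq-Inst {ρ = ρ} _ (∃r {t} {ψ} a b) =
  ∃r (renSeq-Add ρ a) (subst (λ φ → Add (fm φ) _ _ _) (renF-instF ρ t ψ) (renSeq-Add ρ b))
renSeq-Inst {ρ = ρ} ρ-inj (∀r {φ} {y} {𝒬 = Q} a b y∉) =
  ∀r (renSeq-Add ρ a)
     (subst (λ ψ → Add (node [ var (ρ y) ] [ ψ ] []) _ _ _) (renF-instF ρ (var y) φ) (renSeq-Add ρ b))
     (renSeq-∉ Q ρ-inj y∉)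
renSeq-Inst {ρ = ρ} _ (◇r a b p) = ◇r (renSeq-Add ρ a) (renSeq-Add ρ b) (renSeq-PathL ρ p)
renSeq-Inst {ρ = ρ} _ (□r a b) = □r (renSeq-Add ρ a) (renSeq-Add ρ b)
renSeq-Inst {ρ = ρ} _ (ref a) = ref (renSeq-Add ρ a)
renSeq-Inst {ρ = ρ} ρ-inj (rep {N} {z} {t} {s} N-neg a b) =
  rep (renF-IsNegLiteral ρ N-neg)
      (subst (λ φ → Add (fm2 (neq (renT ρ t) (renT ρ s)) φ) _ _ _) (renF-substF ρ-inj z t N) (renSeq-Add ρ a))
      (subst (λ φ → Add (fm φ) _ _ _) (renF-substF ρ-inj z s N) (renSeq-Add ρ b))
renSeq-Inst {ρ = ρ} _ (drep a b) = drep (renSeq-Add ρ a) (renSeq-Add ρ b)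
renSeq-Inst {ρ = ρ} _ (rig a b w≢u) = rig (renSeq-Add ρ a) (renSeq-Add ρ b) w≢u
renSeq-Inst {ρ = ρ} _ (dp-ID ID∈𝒞 DD∉𝒞 a b w≢u p) =
  dp-ID ID∈𝒞 DD∉𝒞 (renSeq-Add ρ a) (renSeq-Add ρ b) w≢u (renSeq-PathL ρ p)
renSeq-Inst {ρ = ρ} _ (dp-DD DD∈𝒞 ID∉𝒞 a b w≢u p) =
  dp-DD DD∈𝒞 ID∉𝒞 (renSeq-Add ρ a) (renSeq-Add ρ b) w≢u (renSeq-PathL ρ p)
renSeq-Inst {ρ = ρ} _ (dp-both ID∈𝒞 DD∈𝒞 a b w≢u p) =
  dp-both ID∈𝒞 DD∈𝒞 (renSeq-Add ρ a) (renSeq-Add ρ b) w≢u (renSeq-PathL ρ p)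
renSeq-Inst {ρ = ρ} _ (d D∈𝒞 a) = d D∈𝒞 (renSeq-Add ρ a)
renSeq-Inst {ρ = ρ} ρ-inj (nd {𝒬 = Q} NE∈𝒞 a y∉) = nd NE∈𝒞 (renSeq-Add ρ a) (renSeq-∉ Q ρ-inj y∉)
renSeq-Inst {ρ = ρ} _ (cd CD∈𝒞 a) = cd CD∈𝒞 (renSeq-Add ρ a)

renSeq-Proof : ∀ {𝒞 ρ} → Injective _≡_ _≡_ ρ → ∀ {Q} (π : Proof 𝒞 Q) →
  Σ (Proof 𝒞 (renSeq ρ Q)) λ π′ → height π′ ≡ height π
renSeq-Proofs : ∀ {𝒞 ρ} → Injective _≡_ _≡_ ρ → ∀ {Ps} (πs : Proofs 𝒞 Ps) →
  Σ (Proofs 𝒞 (map (renSeq ρ) Ps)) λ πs′ → heights πs′ ≡ heights πs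
renSeq-Proof {ρ = ρ} ρ-inj (by q i πs) with renSeq-Proofs ρ-inj πs
... | πs′ , h≡ = by (renSeq-≈ ρ q) (renSeq-Inst ρ-inj i) πs′ , cong suc h≡
renSeq-Proofs ρ-inj [] = [] , refl
renSeq-Proofs ρ-inj (π ∷ πs) with renSeq-Proof ρ-inj π | renSeq-Proofs ρ-inj πs
... | π′ , h≡ | πs′ , hs≡ = π′ ∷ πs′ , cong₂ _⊔_ h≡ hs≡

transpose : ℕ → ℕ → ℕ → ℕ
transpose a b x with x ≟ a
... | yes _ = b
... | no _ with x ≟ b
...   | yes _ = a
...   | no _ = x

data TransposeView (a b x : ℕ) : ℕ → Set where
  at-a : x ≡ a → TransposeView a b x b
  at-b : x ≢ a → x ≡ b → TransposeView a b x a
  elsewhere : x ≢ a → x ≢ b → TransposeView a b x x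

transpose-view : ∀ a b x → TransposeView a b x (transpose a b x)
transpose-view a b x with x ≟ a
... | yes x≡a = at-a x≡a
... | no x≢a with x ≟ b
...   | yes x≡b = at-b x≢a x≡b
...   | no x≢b = elsewhere x≢a x≢b

transpose-a : ∀ a b → transpose a b a ≡ b
transpose-a a b with transpose a b a | transpose-view a b a
... | _ | at-a _ = refl
... | _ | at-b a≢a _ = ⊥-elim (a≢a refl)
... | _ | elsewhere a≢a _ = ⊥-elim (a≢a refl)

transpose-other : ∀ {a b x} → x ≢ a → x ≢ b → transpose a b x ≡ x
transpose-other {a} {b} {x} x≢a x≢b with transpose a b x | transpose-view a b x
... | _ | at-a x≡a = ⊥-elim (x≢a x≡a)
... | _ | at-b _ x≡b = ⊥-elim (x≢b x≡b)
... | _ | elsewhere _ _ = refl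

transpose-involutive : ∀ a b x → transpose a b (transpose a b x) ≡ x
transpose-involutive a b x with transpose a b x | transpose-view a b x
... | _ | at-a refl = transpose-b
  where
  transpose-b : transpose x b b ≡ x
  transpose-b with transpose x b b | transpose-view x b b
  ... | _ | at-a refl = refl
  ... | _ | at-b _ _ = refl
  ... | _ | elsewhere _ b≢b = ⊥-elim (b≢b refl)
... | _ | at-b _ refl = transpose-a a x
... | _ | elsewhere x≢a x≢b = transpose-other x≢a x≢b

transpose-injective : ∀ a b → Injective _≡_ _≡_ (transpose a b)
transpose-injective a b {x} {y} τx≡τy = begin
  x                                     ≡⟨ sym (transpose-involutive a b x) ⟩
  transpose a b (transpose a b x)       ≡⟨ cong (transpose a b) τx≡τy ⟩
  transpose a b (transpose a b y)       ≡⟨ transpose-involutive a b y ⟩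
  y                                     ∎
  where open ≡-Reasoning

fresh : List ℕ → ℕ
fresh xs = suc (max 0 xs)

fresh-∉ : ∀ xs → ¬ (fresh xs ∈ xs)
fresh-∉ xs fresh∈ = <-irrefl refl (All.lookup (xs≤max 0 xs) fresh∈)

∉-fvSeq⇒transpose-fixes : ∀ {a b} A → ¬ (a ∈ fvSeq A) → ¬ (b ∈ fvSeq A) → Fixes (transpose a b) (fvSeq A)
∉-fvSeq⇒transpose-fixes A a∉ b∉ {x} x∈ =
  transpose-other (λ x≡a → a∉ (subst (_∈ fvSeq A) x≡a x∈)) (λ x≡b → b∉ (subst (_∈ fvSeq A) x≡b x∈))

transpose-renSeq-id : ∀ {a b} A → ¬ (a ∈ fvSeq A) → ¬ (b ∈ fvSeq A) → renSeq (transpose a b) A ≡ A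
transpose-renSeq-id A a∉ b∉ = renSeq-id A (∉-fvSeq⇒transpose-fixes A a∉ b∉)

transpose-removes : ∀ {a b} A → ¬ (b ∈ fvSeq A) → ¬ (a ∈ fvSeq (renSeq (transpose a b) A))
transpose-removes {a} {b} A b∉ a∈ with ∈-fvSeq-renSeq⁻ A a∈
... | z , z∈ , a≡τz = b∉ (subst (_∈ fvSeq A) (z≡b z a≡τz) z∈)
  where
  z≡b : ∀ z → a ≡ transpose a b z → z ≡ b
  z≡b z a≡τz =
    ≡-trans (sym (transpose-involutive a b z)) (≡-trans (cong (transpose a b) (sym a≡τz)) (transpose-a a b))

transpose-keeps-∉ : ∀ {a b c} A → c ≢ a → c ≢ b → ¬ (c ∈ fvSeq A) → ¬ (c ∈ fvSeq (renSeq (transpose a b) A))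
transpose-keeps-∉ {a} {b} {c} A c≢a c≢b c∉ c∈ with ∈-fvSeq-renSeq⁻ A c∈
... | z , z∈ , c≡τz = c∉ (subst (_∈ fvSeq A) z≡c z∈)
  where
  z≡c : z ≡ c
  z≡c =
    ≡-trans (sym (transpose-involutive a b z)) (≡-trans (cong (transpose a b) (sym c≡τz)) (transpose-other c≢a c≢b))

module _ {A B : Set} {R : A → B → Set} where

  ↭-Pointwise : ∀ {as as′ bs′} → as ↭ as′ → Pointwise R as′ bs′ → Σ (List B) λ bs → Pointwise R as bs × bs ↭ bs′
  ↭-Pointwise refl p = _ , p , refl
  ↭-Pointwise (prep _ q) (x ∷ p) with ↭-Pointwise q p
  ... | _ , p′ , r = _ , x ∷ p′ , prep _ r
  ↭-Pointwise (swap _ _ q) (x ∷ y ∷ p) with ↭-Pointwise q p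
  ... | _ , p′ , r = _ , y ∷ x ∷ p′ , swap _ _ r
  ↭-Pointwise (trans q q′) p with ↭-Pointwise q′ p
  ... | _ , p₁ , r₁ with ↭-Pointwise q p₁
  ... | _ , p₂ , r₂ = _ , p₂ , trans r₂ r₁

≋⇒Pointwise-↭ : ∀ {xs zs} → xs ≋ zs → Σ (List NSeq) λ ys → Pointwise _≈_ xs ys × ys ↭ zs
≋⇒Pointwise-↭ [] = [] , [] , refl
≋⇒Pointwise-↭ (pick {y = y} l r x≈y p) with ≋⇒Pointwise-↭ p
... | ys , pw , q = y ∷ ys , x≈y ∷ pw , trans (prep y q) (↭-sym (shift y l r))

Pointwise-↭⇒≋ : ∀ {xs ys zs} → Pointwise _≈_ xs ys → ys ↭ zs → xs ≋ zs
Pointwise-↭⇒≋ [] q with ↭-empty-inv (↭-sym q)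
... | refl = []
Pointwise-↭⇒≋ (x≈y ∷ pw) q with ∈-∃++ (∈-resp-↭ q (here refl))
... | l , r , refl = pick l r x≈y (Pointwise-↭⇒≋ pw (drop-mid [] l q))

≈-refl : ∀ A → A ≈ A
≋-refl : ∀ as → as ≋ as
≈-refl (node ts fs cs) = ≈node refl refl (≋-refl cs)
≋-refl [] = []
≋-refl (c ∷ cs) = pick [] cs (≈-refl c) (≋-refl cs)

Pointwise-≈-refl : ∀ as → Pointwise _≈_ as as
Pointwise-≈-refl as = Pointwise.refl (≈-refl _)

≈-trans : ∀ {A B C} → A ≈ B → B ≈ C → A ≈ C
≋-trans : ∀ {as bs cs} → as ≋ bs → bs ≋ cs → as ≋ cs
Pointwise-≈-trans : ∀ {as bs cs} → Pointwise _≈_ as bs → Pointwise _≈_ bs cs → Pointwise _≈_ as cs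
≈-trans {node ts fs cs} (≈node p q r) (≈node p′ q′ r′) = ≈node (trans p p′) (trans q q′) (≋-trans {cs} r r′)
≋-trans {as} r r′ with ≋⇒Pointwise-↭ r | ≋⇒Pointwise-↭ r′
... | _ , pw₁ , q₁ | _ , pw₂ , q₂ with ↭-Pointwise q₁ pw₂
... | _ , pw₃ , q₃ = Pointwise-↭⇒≋ (Pointwise-≈-trans {as} pw₁ pw₃) (trans q₃ q₂)
Pointwise-≈-trans {[]} [] [] = []
Pointwise-≈-trans {a ∷ as} (e ∷ p) (e′ ∷ p′) = ≈-trans {a} e e′ ∷ Pointwise-≈-trans {as} p p′

≈node-Pointwise : ∀ {ts ts′ fs fs′ cs cs′ cs″} → ts ↭ ts′ → fs ↭ fs′ → Pointwise _≈_ cs cs″ → cs″ ↭ cs′ →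
  node ts fs cs ≈ node ts′ fs′ cs′
≈node-Pointwise p q pw r = ≈node p q (Pointwise-↭⇒≋ pw r)

data WPointwise {A B : Set} (R : A → B → ℕ → Set) : List A → List B → ℕ → Set where
  [] : WPointwise R [] [] 0
  _∷_ : ∀ {a b m as bs n} → R a b m → WPointwise R as bs n → WPointwise R (a ∷ as) (b ∷ bs) (m + n)

module _ {A B : Set} {R : A → B → ℕ → Set} where

  WPointwise-++⁺ : ∀ {as bs cs ds m n} → WPointwise R as bs m → WPointwise R cs ds n →
    WPointwise R (as ++ cs) (bs ++ ds) (m + n)
  WPointwise-++⁺ [] q = q
  WPointwise-++⁺ {n = n′} (_∷_ {m = m} {n = n} x p) q =
    subst (WPointwise R _ _) (sym (+-assoc m n n′)) (x ∷ WPointwise-++⁺ p q)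

  WPointwise-++⁻ : ∀ as {cs bs n} → WPointwise R (as ++ cs) bs n →
    Σ (List B) λ bs₁ → Σ (List B) λ bs₂ → Σ ℕ λ n₁ → Σ ℕ λ n₂ →
      bs ≡ bs₁ ++ bs₂ × WPointwise R as bs₁ n₁ × WPointwise R cs bs₂ n₂ × n ≡ n₁ + n₂
  WPointwise-++⁻ [] p = [] , _ , 0 , _ , refl , [] , p , refl
  WPointwise-++⁻ (a ∷ as) (_∷_ {m = m} x p) with WPointwise-++⁻ as p
  ... | bs₁ , bs₂ , n₁ , n₂ , refl , p₁ , p₂ , refl =
    _ ∷ bs₁ , bs₂ , m + n₁ , n₂ , refl , x ∷ p₁ , p₂ , sym (+-assoc m n₁ n₂)

  WPointwise-↭ : ∀ {as as′ bs n} → WPointwise R as bs n → as ↭ as′ →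
    Σ (List B) λ bs′ → WPointwise R as′ bs′ n × bs ↭ bs′
  WPointwise-↭ p refl = _ , p , refl
  WPointwise-↭ (x ∷ p) (prep _ q) with WPointwise-↭ p q
  ... | _ , p′ , r = _ , x ∷ p′ , prep _ r
  WPointwise-↭ (_∷_ {m = m₁} x (_∷_ {m = m₂} {n = n} y p)) (swap _ _ q) with WPointwise-↭ p q
  ... | _ , p′ , r = _ , subst (WPointwise R _ _) (exchange m₁ m₂ n) (y ∷ (x ∷ p′)) , swap _ _ r
    where
    exchange : ∀ a b c → b + (a + c) ≡ a + (b + c)
    exchange = solve-∀
  WPointwise-↭ p (trans q q′) with WPointwise-↭ p q
  ... | _ , p₁ , r₁ with WPointwise-↭ p₁ q′
  ... | _ , p₂ , r₂ = _ , p₂ , trans r₁ r₂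

  WPointwise-focus : ∀ l {c r bs n} → WPointwise R (l ++ c ∷ r) bs n →
    Σ (List B) λ l′ → Σ B λ c′ → Σ (List B) λ r′ → Σ ℕ λ nl → Σ ℕ λ m → Σ ℕ λ nr →
      bs ≡ l′ ++ c′ ∷ r′ × length l′ ≡ length l ×
      WPointwise R l l′ nl × R c c′ m × WPointwise R r r′ nr × n ≡ nl + (m + nr)
  WPointwise-focus [] (x ∷ p) = [] , _ , _ , 0 , _ , _ , refl , refl , [] , x , p , refl
  WPointwise-focus (a ∷ l) (_∷_ {m = m₀} x p) with WPointwise-focus l p
  ... | l′ , c′ , r′ , nl , m , nr , refl , l≡ , pl , y , pr , refl =
    _ ∷ l′ , c′ , r′ , m₀ + nl , m , nr , refl , cong suc l≡ , x ∷ pl , y , pr , sym (+-assoc m₀ nl (m + nr))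

concatMap-↭ : ∀ {A B : Set} (f : A → List B) {xs ys} → xs ↭ ys → concatMap f xs ↭ concatMap f ys
concatMap-↭ f refl = refl
concatMap-↭ f (prep x p) = ++⁺ˡ (f x) (concatMap-↭ f p)
concatMap-↭ f (swap x y p) = trans (shifts (f x) (f y)) (++⁺ˡ (f y) (++⁺ˡ (f x) (concatMap-↭ f p)))
concatMap-↭ f (trans p q) = trans (concatMap-↭ f p) (concatMap-↭ f q)

++-∷-injective : ∀ {A : Set} (a b : List A) {x y : A} {xs ys} → length a ≡ length b →
  a ++ x ∷ xs ≡ b ++ y ∷ ys → a ≡ b × x ≡ y × xs ≡ ys
++-∷-injective [] [] _ refl = refl , refl , refl
++-∷-injective (u ∷ a) (v ∷ b) |a|≡|b| a++≡b++ with ∷-injective a++≡b++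
... | refl , a++≡b++′ with ++-∷-injective a b (cong pred |a|≡|b|) a++≡b++′
... | refl , refl , refl = refl , refl , refl

module ListSolver (A : Set) = CommutativeMonoidSolver (++-commutativeMonoid {A = A})
module TmSolver = ListSolver Tm
module FmSolver = ListSolver Fm
module NSeqSolver = ListSolver NSeq
module VarSolver = ListSolver ℕ

-- Expansions

data Kind : Set where
  weakening : Kind
  invert-∨ : Fm → Fm → Kind
  invert-∧₁ invert-∧₂ : Fm → Fm → Kind
  invert-∀ : Formula 1 → ℕ → Kind
  invert-□ : Fm → Kind

data Replaces : Kind → Fm → NSeq → ℕ → Set where
  keep : ∀ {k φ} → Replaces k φ (fm φ) 0
  replace-∨ : ∀ {φ ψ} → Replaces (invert-∨ φ ψ) (or φ ψ) (fm2 φ ψ) 1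
  replace-∧₁ : ∀ {φ ψ} → Replaces (invert-∧₁ φ ψ) (and φ ψ) (fm φ) 1
  replace-∧₂ : ∀ {φ ψ} → Replaces (invert-∧₂ φ ψ) (and φ ψ) (fm ψ) 1
  replace-∀ : ∀ {φ y} → Replaces (invert-∀ φ y) (all φ) (node [ var y ] [ instF (var y) φ ] []) 1
  replace-□ : ∀ {φ} → Replaces (invert-□ φ) (box φ) (node [] [] [ fm φ ]) 1

ReplacesAll : Kind → List Fm → List NSeq → ℕ → Set
ReplacesAll k = WPointwise (Replaces k)

sigOf : NSeq → List Tm
sigOf (node ts _ _) = ts

fmlsOf : NSeq → List Fm
fmlsOf (node _ fs _) = fs

kidsOf : NSeq → List NSeq
kidsOf (node _ _ cs) = cs

allSigs : List NSeq → List Tm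
allSigs = concatMap sigOf

allFmls : List NSeq → List Fm
allFmls = concatMap fmlsOf

allKids : List NSeq → List NSeq
allKids = concatMap kidsOf

-- In every component each formula φ is replaced by some C with Replaces k φ C _ (keep being the trivial
-- replacement): the root of C is merged into the component and its children become new children.  The
-- weights of the replacements add up to n.  Arbitrary terms tx, formulas fx and components cx are then
-- added, and the old and new children are expanded recursively.
data Expands (k : Kind) : NSeq → NSeq → ℕ → Set where
  expands : ∀ {ts fs cs ts′ fs′ cs′ rs m rcs tx fx cs₁ cx n}
    → ReplacesAll k fs rs m
    → ts′ ↭ ts ++ allSigs rs ++ tx
    → fs′ ↭ allFmls rs ++ fx
    → rcs ↭ allKids rs
    → WPointwise (Expands k) (cs ++ rcs) cs₁ n
    → cs′ ≡ cs₁ ++ cx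
    → Expands k (node ts fs cs) (node ts′ fs′ cs′) (m + n)

ExpandsAll : Kind → List NSeq → List NSeq → ℕ → Set
ExpandsAll k = WPointwise (Expands k)

ReplacesAll-keep : ∀ {k} fs → ReplacesAll k fs (map fm fs) 0
ReplacesAll-keep [] = []
ReplacesAll-keep (f ∷ fs) = keep ∷ ReplacesAll-keep fs

allSigs-keep : ∀ fs → allSigs (map fm fs) ≡ []
allSigs-keep [] = refl
allSigs-keep (f ∷ fs) = allSigs-keep fs

allFmls-keep : ∀ fs → allFmls (map fm fs) ≡ fs
allFmls-keep [] = refl
allFmls-keep (f ∷ fs) = cong (f ∷_) (allFmls-keep fs)

allKids-keep : ∀ fs → allKids (map fm fs) ≡ []
allKids-keep [] = refl
allKids-keep (f ∷ fs) = allKids-keep fs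

ReplacesAll-zero : ∀ {k fs rs n} → ReplacesAll k fs rs n → n ≡ 0 → rs ≡ map fm fs
ReplacesAll-zero [] _ = refl
ReplacesAll-zero (keep ∷ p) n≡0 = cong (_ ∷_) (ReplacesAll-zero p n≡0)
ReplacesAll-zero (replace-∨ ∷ p) ()
ReplacesAll-zero (replace-∧₁ ∷ p) ()
ReplacesAll-zero (replace-∧₂ ∷ p) ()
ReplacesAll-zero (replace-∀ ∷ p) ()
ReplacesAll-zero (replace-□ ∷ p) ()

Expands-refl : ∀ k A → Expands k A A 0
ExpandsAll-refl : ∀ k cs → ExpandsAll k cs cs 0
Expands-refl k (node ts fs cs) =
  expands (ReplacesAll-keep fs)
    (↭-reflexive (sym (≡-trans (cong (λ z → ts ++ z ++ []) (allSigs-keep fs)) (++-identityʳ ts))))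
    (↭-reflexive (sym (≡-trans (cong (_++ []) (allFmls-keep fs)) (++-identityʳ fs))))
    (↭-reflexive (sym (allKids-keep fs)))
    (WPointwise-++⁺ (ExpandsAll-refl k cs) [])
    (sym (≡-trans (++-identityʳ (cs ++ [])) (++-identityʳ cs)))
ExpandsAll-refl k [] = []
ExpandsAll-refl k (c ∷ cs) = Expands-refl k c ∷ ExpandsAll-refl k cs

ExpandsAll-focus : ∀ {k} l {c r rcs bs n} → ExpandsAll k ((l ++ c ∷ r) ++ rcs) bs n →
  Σ (List NSeq) λ l′ → Σ NSeq λ c′ → Σ (List NSeq) λ r′ → Σ ℕ λ nl → Σ ℕ λ m → Σ ℕ λ nr →
    bs ≡ l′ ++ c′ ∷ r′ × length l′ ≡ length l ×
    ExpandsAll k l l′ nl × Expands k c c′ m × ExpandsAll k (r ++ rcs) r′ nr × n ≡ nl + (m + nr)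
ExpandsAll-focus {k} l {c} {r} {rcs} {bs} {n} p =
  WPointwise-focus l (subst (λ cs → ExpandsAll k cs bs n) (++-assoc l (c ∷ r) rcs) p)

ExpandsAll-unfocus : ∀ {k} l {c r rcs l′ c′ r′ nl m nr} →
  ExpandsAll k l l′ nl → Expands k c c′ m → ExpandsAll k (r ++ rcs) r′ nr →
  ExpandsAll k ((l ++ c ∷ r) ++ rcs) (l′ ++ c′ ∷ r′) (nl + (m + nr))
ExpandsAll-unfocus {k} l {c} {r} {rcs} pl x pr =
  subst (λ cs → ExpandsAll k cs _ _) (sym (++-assoc l (c ∷ r) rcs)) (WPointwise-++⁺ pl (x ∷ pr))

Expands-IsPos : ∀ {k A A′ n p} → Expands k A A′ n → IsPos A p → IsPos A′ p
Expands-IsPos e root = root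
Expands-IsPos (expands {ts′ = ts′} {fs′ = fs′} {cx = cx} _ _ _ _ es refl) (child {l = l} {c} {r} {p} h)
  with ExpandsAll-focus l es
... | l′ , c′ , r′ , _ , _ , _ , refl , l≡ , _ , e , _ , _ =
  subst₂ (λ cs i → IsPos (node ts′ fs′ cs) (i ∷ p)) (sym (++-assoc l′ (c′ ∷ r′) cx)) l≡ (child (Expands-IsPos e h))

Expands-Path : ∀ {k A A′ n s w u} → Expands k A A′ n → Path A s w u → Path A′ s w u
Expands-Path e (nil x) = nil (Expands-IsPos e x)
Expands-Path e (fwd (i , q , x) p) = fwd (i , q , Expands-IsPos e x) (Expands-Path e p)
Expands-Path e (bwd (i , q , x) p) = bwd (i , q , Expands-IsPos e x) (Expands-Path e p)

Expands-PathL : ∀ {k A A′ n L w u} → Expands k A A′ n → PathL A L w u → PathL A′ L w u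
Expands-PathL e (s , s∈L , p) = s , s∈L , Expands-Path e p

Expands-≈ : ∀ {k A A₀ A′ n} → A ≈ A₀ → Expands k A A′ n → Σ NSeq λ A₀′ → Expands k A₀ A₀′ n × A′ ≈ A₀′
ExpandsAll-≈ : ∀ {k cs ys csa na} → Pointwise _≈_ cs ys → ExpandsAll k cs csa na →
  Σ (List NSeq) λ ysa → ExpandsAll k ys ysa na × Pointwise _≈_ csa ysa
Expands-≈ {k} {node ts fs cs} (≈node p q r)
    (expands {ts′ = ts′} {fs′ = fs′} {tx = tx} {fx = fx} {cx = cx} rps tp fp rcp es refl)
  with WPointwise-↭ rps q
... | _ , rps₀ , rq with WPointwise-++⁻ cs es
... | csa , csb , _ , _ , refl , esa , esb , refl with ≋⇒Pointwise-↭ r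
... | _ , pw , yq with ExpandsAll-≈ pw esa
... | _ , esy , pwa with WPointwise-↭ esy yq
... | csa₀ , esa₀ , aq =
  node ts′ fs′ ((csa₀ ++ csb) ++ cx) ,
  expands rps₀ (trans tp (++⁺ p (++⁺ʳ tx (concatMap-↭ sigOf rq)))) (trans fp (++⁺ʳ fx (concatMap-↭ fmlsOf rq)))
    (trans rcp (concatMap-↭ kidsOf rq)) (WPointwise-++⁺ esa₀ esb) refl ,
  ≈node-Pointwise refl refl (Pointwise.++⁺ (Pointwise.++⁺ pwa (Pointwise-≈-refl csb)) (Pointwise-≈-refl cx))
    (++⁺ʳ cx (++⁺ʳ csb aq))
ExpandsAll-≈ [] [] = [] , [] , []
ExpandsAll-≈ (q ∷ pw) (e ∷ es) with Expands-≈ q e | ExpandsAll-≈ pw es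
... | c′ , e′ , q′ | ys′ , es′ , pw′ = c′ ∷ ys′ , e′ ∷ es′ , q′ ∷ pw′

Expands-merge : ∀ {k ts fs cs ts′ fs′ cs′ hts hfs hcs hts′ hfs′ hcs′ n₁ n₂} →
  Expands k (node ts fs cs) (node ts′ fs′ cs′) n₁ → Expands k (node hts hfs hcs) (node hts′ hfs′ hcs′) n₂ →
  let P′ = node (ts′ ++ hts′) (fs′ ++ hfs′) (cs′ ++ hcs′) in
  Σ NSeq λ P̃ → Expands k (node (ts ++ hts) (fs ++ hfs) (cs ++ hcs)) P̃ (n₁ + n₂) × P′ ≈ P̃ × (hcs′ ≡ [] → P̃ ≡ P′)
Expands-merge {k} {ts} {fs} {cs} {ts′} {fs′} {hts = hts} {hfs} {hcs} {hts′} {hfs′}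
    (expands {rs = rs} {m} {rcs} {tx} {fx} {cx = cx} rps tp fp rcp es refl)
    (expands {rs = hrs} {hm} {hrcs} {htx} {hfx} {cx = hcx} hrps htp hfp hrcp hes refl)
  with WPointwise-++⁻ cs es | WPointwise-++⁻ hcs hes
... | csa , csb , na₁ , na₂ , refl , esa , esb , refl | hca , hcb , nh₁ , nh₂ , refl , hesa , hesb , refl =
  node (ts′ ++ hts′) (fs′ ++ hfs′) (((csa ++ hca) ++ (csb ++ hcb)) ++ (cx ++ hcx)) ,
  subst (Expands k _ _) (sym (weights m na₁ na₂ hm nh₁ nh₂))
    (expands (WPointwise-++⁺ rps hrps) sigs↭ fmls↭ kids↭
       (WPointwise-++⁺ (WPointwise-++⁺ esa hesa) (WPointwise-++⁺ esb hesb)) refl) ,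
  ≈node-Pointwise refl refl (Pointwise-≈-refl _) kids-order ,
  no-new-kids
  where
  weights : ∀ a b c d e f → (a + (b + c)) + (d + (e + f)) ≡ (a + d) + ((b + e) + (c + f))
  weights = solve-∀
  sigs↭ : ts′ ++ hts′ ↭ (ts ++ hts) ++ allSigs (rs ++ hrs) ++ (tx ++ htx)
  sigs↭ = trans (++⁺ tp htp)
    (subst (λ z → (ts ++ allSigs rs ++ tx) ++ (hts ++ allSigs hrs ++ htx) ↭ (ts ++ hts) ++ z ++ (tx ++ htx))
      (sym (concatMap-++ sigOf rs hrs))
      (solve 6 (λ a b c d e f → (a ⊕ (b ⊕ c)) ⊕ (d ⊕ (e ⊕ f)) ⊜ (a ⊕ d) ⊕ ((b ⊕ e) ⊕ (c ⊕ f)))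
        refl ts (allSigs rs) tx hts (allSigs hrs) htx))
    where open TmSolver
  fmls↭ : fs′ ++ hfs′ ↭ allFmls (rs ++ hrs) ++ (fx ++ hfx)
  fmls↭ = trans (++⁺ fp hfp)
    (subst (λ z → (allFmls rs ++ fx) ++ (allFmls hrs ++ hfx) ↭ z ++ (fx ++ hfx)) (sym (concatMap-++ fmlsOf rs hrs))
      (solve 4 (λ a b c d → (a ⊕ b) ⊕ (c ⊕ d) ⊜ (a ⊕ c) ⊕ (b ⊕ d)) refl (allFmls rs) fx (allFmls hrs) hfx))
    where open FmSolver
  kids↭ : rcs ++ hrcs ↭ allKids (rs ++ hrs)
  kids↭ = subst (rcs ++ hrcs ↭_) (sym (concatMap-++ kidsOf rs hrs)) (++⁺ rcp hrcp)
  kids-order : ((csa ++ csb) ++ cx) ++ ((hca ++ hcb) ++ hcx) ↭ ((csa ++ hca) ++ (csb ++ hcb)) ++ (cx ++ hcx)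
  kids-order = solve 6 (λ a b c d e f → ((a ⊕ b) ⊕ c) ⊕ ((d ⊕ e) ⊕ f) ⊜ ((a ⊕ d) ⊕ (b ⊕ e)) ⊕ (c ⊕ f))
    refl csa csb cx hca hcb hcx
    where open NSeqSolver
  no-new-kids : (hca ++ hcb) ++ hcx ≡ [] →
    node (ts′ ++ hts′) (fs′ ++ hfs′) (((csa ++ hca) ++ (csb ++ hcb)) ++ (cx ++ hcx))
      ≡ node (ts′ ++ hts′) (fs′ ++ hfs′) (((csa ++ csb) ++ cx) ++ ((hca ++ hcb) ++ hcx))
  no-new-kids none
    with ++-conicalˡ hca hcb (++-conicalˡ (hca ++ hcb) hcx none)
       | ++-conicalʳ hca hcb (++-conicalˡ (hca ++ hcb) hcx none)
       | ++-conicalʳ (hca ++ hcb) hcx none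
  ... | refl | refl | refl =
    cong (node (ts′ ++ hts′) (fs′ ++ hfs′))
      (≡-trans (cong₂ (λ a b → (a ++ b) ++ (cx ++ [])) (++-identityʳ csa) (++-identityʳ csb))
               (sym (++-assoc (csa ++ csb) cx [])))

Expands-Add : ∀ {k H H′ w w′ A A′ P P′ n₁ n₂} → Add H w A P → Add H′ w′ A′ P′ → w ≡ w′ →
  Expands k A A′ n₁ → Expands k H H′ n₂ →
  Σ NSeq λ P̃ → Expands k P P̃ (n₁ + n₂) × P′ ≈ P̃ × (kidsOf H′ ≡ [] → P̃ ≡ P′)
Expands-Add (here refl) (here refl) refl e eH = Expands-merge e eH
Expands-Add {k} (there {l = l} {c} {r = r} a) (there {l = l₁} a′) w≡w′
    (expands {ts′ = ts′} {fs′ = fs′} {m = m₀} {cx = cx} rps tp fp rcp es cs′≡) eH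
  with ∷-injective w≡w′ | ExpandsAll-focus l es
... | |l|≡|l₁| , p≡p′ | l′ , c′ , r′ , nl , m , nr , refl , l≡ , el , e , er , refl
  with ++-∷-injective l₁ l′ (≡-trans (sym |l|≡|l₁|) (sym l≡)) (≡-trans cs′≡ (++-assoc l′ (c′ ∷ r′) cx))
... | refl , refl , refl with Expands-Add a a′ p≡p′ e eH
... | P̃ , e′ , P′≈P̃ , exact =
  node ts′ fs′ (l′ ++ P̃ ∷ (r′ ++ cx)) ,
  subst (Expands k _ _) (weights m₀ nl m _ nr)
    (expands rps tp fp rcp (ExpandsAll-unfocus l el e′ er) (sym (++-assoc l′ (P̃ ∷ r′) cx))) ,
  ≈node-Pointwise refl refl (Pointwise.++⁺ (Pointwise-≈-refl l′) (P′≈P̃ ∷ Pointwise-≈-refl (r′ ++ cx))) refl ,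
  (λ none → cong (λ z → node ts′ fs′ (l′ ++ z ∷ (r′ ++ cx))) (exact none))
  where
  weights : ∀ a b c d e → a + (b + ((c + d) + e)) ≡ (a + (b + (c + e))) + d
  weights = solve-∀

Expands-Add⁻ : ∀ {k hts hfs w G Q Q′ n} → Add (node hts hfs []) w G Q → Expands k Q Q′ n →
  Σ (List NSeq) λ rsH → Σ ℕ λ mH → ReplacesAll k hfs rsH mH ×
  Σ (List NSeq) λ kids′ → Σ ℕ λ mK → ExpandsAll k (allKids rsH) kids′ mK ×
  Σ ℕ λ nG → n ≡ nG + (mH + mK) ×
  Σ NSeq λ G′ → Σ NSeq λ X → Expands k G G′ nG × Add (node (hts ++ allSigs rsH) (allFmls rsH) kids′) w G′ X × Q′ ≈ X
Expands-Add⁻ {k} {hts} {hfs} (here {ts} {fs} {cs} refl)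
    (expands {rcs = rcs} {tx = tx} {fx = fx} {cx = cx} rps tp fp rcp es refl)
  with WPointwise-++⁻ fs rps
... | rsG , rsH , mG , mH , refl , rpsG , rpsH , refl
  with WPointwise-++⁻ (cs ++ []) es
... | csa , csb , na , nb , refl , esa , esb , refl
  with WPointwise-↭ esb (subst (rcs ↭_) (concatMap-++ kidsOf rsG rsH) rcp)
... | _ , esb′ , bq
  with WPointwise-++⁻ (allKids rsG) esb′
... | cG , cH , nbG , nbH , refl , esG , esH , refl =
  rsH , mH , rpsH , cH , nbH , esH , mG + (na + nbG) , weights mG mH na nbG nbH ,
  node (ts ++ allSigs rsG ++ tx) (allFmls rsG ++ fx) ((csa ++ cG) ++ cx) , _ ,
  expands rpsG refl refl refl (WPointwise-++⁺ (subst (λ z → ExpandsAll k z csa na) (++-identityʳ cs) esa) esG) refl ,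
  here refl ,
  ≈node-Pointwise
    (trans tp (subst (λ z → (ts ++ hts) ++ z ++ tx ↭ (ts ++ allSigs rsG ++ tx) ++ (hts ++ allSigs rsH))
                 (sym (concatMap-++ sigOf rsG rsH)) sigs-order))
    (trans fp (subst (λ z → z ++ fx ↭ (allFmls rsG ++ fx) ++ allFmls rsH) (sym (concatMap-++ fmlsOf rsG rsH)) fmls-order))
    (Pointwise-≈-refl _)
    (trans (++⁺ʳ cx (++⁺ˡ csa bq)) kids-order)
  where
  weights : ∀ a b c d e → (a + b) + (c + (d + e)) ≡ (a + (c + d)) + (b + e)
  weights = solve-∀
  sigs-order : (ts ++ hts) ++ (allSigs rsG ++ allSigs rsH) ++ tx ↭ (ts ++ allSigs rsG ++ tx) ++ (hts ++ allSigs rsH)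
  sigs-order = solve 5 (λ a b c d e → (a ⊕ b) ⊕ ((c ⊕ d) ⊕ e) ⊜ (a ⊕ (c ⊕ e)) ⊕ (b ⊕ d))
    refl ts hts (allSigs rsG) (allSigs rsH) tx
    where open TmSolver
  fmls-order : (allFmls rsG ++ allFmls rsH) ++ fx ↭ (allFmls rsG ++ fx) ++ allFmls rsH
  fmls-order = solve 3 (λ a b c → (a ⊕ b) ⊕ c ⊜ (a ⊕ c) ⊕ b) refl (allFmls rsG) (allFmls rsH) fx
    where open FmSolver
  kids-order : (csa ++ (cG ++ cH)) ++ cx ↭ ((csa ++ cG) ++ cx) ++ cH
  kids-order = solve 4 (λ a b c d → (a ⊕ (b ⊕ c)) ⊕ d ⊜ ((a ⊕ b) ⊕ d) ⊕ c) refl csa cG cH cx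
    where open NSeqSolver
Expands-Add⁻ {k} (there {l = l} {p = p} a)
    (expands {ts′ = ts′} {fs′ = fs′} {m = m₀} {cx = cx} rps tp fp rcp es refl)
  with ExpandsAll-focus l es
... | l′ , c′ , r′ , nl , m , nr , refl , l≡ , el , e , er , refl
  with Expands-Add⁻ a e
... | rsH , mH , rpsH , kids′ , mK , esK , nGc , refl , Gc , Xc , eGc , addc , c′≈Xc =
  rsH , mH , rpsH , kids′ , mK , esK , m₀ + (nl + (nGc + nr)) , weights m₀ nl nGc mH mK nr ,
  node ts′ fs′ (l′ ++ Gc ∷ (r′ ++ cx)) , node ts′ fs′ (l′ ++ Xc ∷ (r′ ++ cx)) ,
  expands rps tp fp rcp (ExpandsAll-unfocus l el eGc er) (sym (++-assoc l′ (Gc ∷ r′) cx)) ,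
  subst (λ i → Add _ (i ∷ p) (node ts′ fs′ (l′ ++ Gc ∷ (r′ ++ cx))) (node ts′ fs′ (l′ ++ Xc ∷ (r′ ++ cx))))
    l≡ (there addc) ,
  ≈node-Pointwise refl refl
    (Pointwise.++⁺ (Pointwise.++⁺ (Pointwise-≈-refl l′) (c′≈Xc ∷ Pointwise-≈-refl r′)) (Pointwise-≈-refl cx))
    (↭-reflexive (++-assoc l′ (Xc ∷ r′) cx))
  where
  weights : ∀ a b c d e f → a + (b + ((c + (d + e)) + f)) ≡ (a + (b + (c + f))) + (d + e)
  weights = solve-∀

Add-IsPos : ∀ {H w G Q} → Add H w G Q → IsPos G w
Add-IsPos (here _) = root
Add-IsPos (there a) = child (Add-IsPos a)

IsPos⇒Add : ∀ H {A w} → IsPos A w → Σ NSeq λ P → Add H w A P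
IsPos⇒Add (node _ _ _) {node _ _ _} root = _ , here refl
IsPos⇒Add H (child h) with IsPos⇒Add H h
... | _ , a = _ , there a

fvSeqs-++ : ∀ cs cs′ → fvSeqs (cs ++ cs′) ≡ fvSeqs cs ++ fvSeqs cs′
fvSeqs-++ [] cs′ = refl
fvSeqs-++ (c ∷ cs) cs′ = ≡-trans (cong (fvSeq c ++_) (fvSeqs-++ cs cs′)) (sym (++-assoc (fvSeq c) _ _))

fvSeqs≡concatMap : ∀ cs → fvSeqs cs ≡ concatMap fvSeq cs
fvSeqs≡concatMap [] = refl
fvSeqs≡concatMap (c ∷ cs) = cong (fvSeq c ++_) (fvSeqs≡concatMap cs)

fvSeq-Add : ∀ {H w G Q} → Add H w G Q → fvSeq Q ↭ fvSeq G ++ fvSeq H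
fvSeq-Add (here {ts} {fs} {cs} {ts′} {fs′} {cs′} refl)
  rewrite concatMap-++ fvT ts ts′ | concatMap-++ fvF fs fs′ | fvSeqs-++ cs cs′ =
  solve 6 (λ a a′ b b′ c c′ → (a ⊕ a′) ⊕ ((b ⊕ b′) ⊕ (c ⊕ c′)) ⊜ (a ⊕ (b ⊕ c)) ⊕ (a′ ⊕ (b′ ⊕ c′)))
    refl (concatMap fvT ts) (concatMap fvT ts′) (concatMap fvF fs) (concatMap fvF fs′) (fvSeqs cs) (fvSeqs cs′)
  where open VarSolver
fvSeq-Add {H} (there {ts} {fs} {l} {c} {c′} {r} a)
  rewrite fvSeqs-++ l (c′ ∷ r) | fvSeqs-++ l (c ∷ r) =
  trans (++⁺ˡ (concatMap fvT ts) (++⁺ˡ (concatMap fvF fs) (++⁺ˡ (fvSeqs l) (++⁺ʳ (fvSeqs r) (fvSeq-Add a)))))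
    (solve 6 (λ x y z u v w → x ⊕ (y ⊕ (z ⊕ ((u ⊕ w) ⊕ v))) ⊜ (x ⊕ (y ⊕ (z ⊕ (u ⊕ v)))) ⊕ w)
      refl (concatMap fvT ts) (concatMap fvF fs) (fvSeqs l) (fvSeq c) (fvSeqs r) (fvSeq H))
  where open VarSolver

∉-Addˡ : ∀ {H w G Q x} → Add H w G Q → ¬ (x ∈ fvSeq Q) → ¬ (x ∈ fvSeq G)
∉-Addˡ a x∉ x∈ = x∉ (∈-resp-↭ (↭-sym (fvSeq-Add a)) (∈-++⁺ˡ x∈))

∈-Addʳ : ∀ {H w G Q x} → Add H w G Q → x ∈ fvSeq H → x ∈ fvSeq Q
∈-Addʳ {G = G₀} a x∈ = ∈-resp-↭ (↭-sym (fvSeq-Add a)) (∈-++⁺ʳ (fvSeq G₀) x∈)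

∉-Addʳ : ∀ {H w G Q x} → Add H w G Q → ¬ (x ∈ fvSeq Q) → ¬ (x ∈ fvSeq H)
∉-Addʳ a x∉ = x∉ ∘ ∈-Addʳ a

fvSeq-≈ : ∀ {A B} → A ≈ B → fvSeq A ↭ fvSeq B
fvSeqs-Pointwise-≈ : ∀ {cs cs′} → Pointwise _≈_ cs cs′ → fvSeqs cs ↭ fvSeqs cs′
fvSeq-≈ {node ts fs cs} (≈node {cs′ = cs′} p q r) with ≋⇒Pointwise-↭ r
... | ys , pw , yq =
  ++⁺ (concatMap-↭ fvT p) (++⁺ (concatMap-↭ fvF q)
    (trans (fvSeqs-Pointwise-≈ {cs} pw)
      (subst₂ _↭_ (sym (fvSeqs≡concatMap ys)) (sym (fvSeqs≡concatMap cs′)) (concatMap-↭ fvSeq yq))))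
fvSeqs-Pointwise-≈ [] = refl
fvSeqs-Pointwise-≈ {c ∷ cs} (e ∷ pw) = ++⁺ (fvSeq-≈ {c} e) (fvSeqs-Pointwise-≈ {cs} pw)

∉-≈ : ∀ {A B x} → A ≈ B → ¬ (x ∈ fvSeq A) → ¬ (x ∈ fvSeq B)
∉-≈ A≈B x∉ x∈ = x∉ (∈-resp-↭ (↭-sym (fvSeq-≈ A≈B)) x∈)

‾-IsLiteral : ∀ {L} → IsLiteral L → IsLiteral (‾ L)
‾-IsLiteral lit-pos = lit-neg
‾-IsLiteral lit-neg = lit-pos
‾-IsLiteral lit-eq = lit-neq
‾-IsLiteral lit-neq = lit-eq

substF-IsLiteral : ∀ {N z t} → IsNegLiteral N → IsLiteral (substF z t N)
substF-IsLiteral nlit-neg = lit-neg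
substF-IsLiteral nlit-neq = lit-neq

Unreplaceable : Kind → List Fm → Set
Unreplaceable k fs = ∀ {rs m} → ReplacesAll k fs rs m → m ≡ 0

literals-unreplaceable : ∀ {k fs} → All IsLiteral fs → Unreplaceable k fs
literals-unreplaceable [] [] = refl
literals-unreplaceable (lit-pos ∷ ls) (keep ∷ rps) = literals-unreplaceable ls rps
literals-unreplaceable (lit-neg ∷ ls) (keep ∷ rps) = literals-unreplaceable ls rps
literals-unreplaceable (lit-eq ∷ ls) (keep ∷ rps) = literals-unreplaceable ls rps
literals-unreplaceable (lit-neq ∷ ls) (keep ∷ rps) = literals-unreplaceable ls rps

eigenvariables : Kind → List ℕ
eigenvariables (invert-∀ _ y) = [ y ]
eigenvariables _ = []

Fresh : Kind → NSeq → Set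
Fresh k Q = ∀ {y} → y ∈ eigenvariables k → ¬ (y ∈ fvSeq Q)

FreshFor : Kind → ℕ → NSeq → Set
FreshFor k n P = n ≡ 0 ⊎ Fresh k P

data Inversion (k : Kind) (Q Q′ : NSeq) : Set where
  inversion : ∀ {n Q″} → n ≤ 1 → Expands k Q Q″ n → Q′ ≈ Q″ → FreshFor k n Q → Inversion k Q Q′

Fresh-≈ : ∀ {k A B} → A ≈ B → Fresh k A → Fresh k B
Fresh-≈ A≈B A-fresh y∈ = ∉-≈ A≈B (A-fresh y∈)

Fresh-transpose : ∀ {k a b P} → ¬ (b ∈ eigenvariables k) → a ∈ fvSeq P → Fresh k P → Fresh k (renSeq (transpose a b) P)
Fresh-transpose {P = P} b∉ a∈ P-fresh {y} y∈ =
  transpose-keeps-∉ P (λ { refl → P-fresh y∈ a∈ }) (λ { refl → b∉ y∈ }) (P-fresh y∈)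

Add-Inversion : ∀ {k G G″ n u H P} → n ≤ 1 → Expands k G G″ n → Add H u G P → FreshFor k n P →
  Σ NSeq λ P′ → Add H u G″ P′ × Inversion k P P′
Add-Inversion {k} {H = H} n≤1 e b P-fresh with IsPos⇒Add H (Expands-IsPos e (Add-IsPos b))
... | P′ , b′ with Expands-Add b b′ refl e (Expands-refl k H)
... | P̃ , e′ , P′≈P̃ , _ = P′ , b′ , inversion n≤1 (subst (Expands k _ _) (+-identityʳ _) e′) P′≈P̃ P-fresh

one-replacement : ∀ {n a b} → n ≤ 1 → n ≡ a + (1 + b) → a ≡ 0 × b ≡ 0 × n ≡ 1
one-replacement {a = zero} {zero} _ refl = refl , refl , refl
one-replacement {a = zero} {suc b} (s≤s ()) refl
one-replacement {a = suc zero} (s≤s ()) refl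
one-replacement {a = suc (suc a)} (s≤s ()) refl

Expands-Add⁻-kept : ∀ {k hts hfs w G Q₀ n rsH kids′ mK nG G″ X} →
  Add (node hts hfs []) w G Q₀ → ReplacesAll k hfs rsH 0 → ExpandsAll k (allKids rsH) kids′ mK → n ≡ nG + (0 + mK) →
  Expands k G G″ nG → Add (node (hts ++ allSigs rsH) (allFmls rsH) kids′) w G″ X →
  Expands k G G″ n × Add (node hts hfs []) w G″ X × Expands k Q₀ X n
Expands-Add⁻-kept {k} {hts} {hfs} {nG = nG} a rps es refl eG addX with ReplacesAll-zero rps refl
... | refl with subst (λ cs → ExpandsAll k cs _ _) (allKids-keep hfs) es
... | [] with subst₂ (λ ts fs → Add (node ts fs []) _ _ _)
                (≡-trans (cong (hts ++_) (allSigs-keep hfs)) (++-identityʳ hts)) (allFmls-keep hfs) addX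
... | addX′ with Expands-Add a addX′ refl eG (Expands-refl k (node hts hfs []))
... | _ , eQ , _ , exact with exact refl
... | refl = subst (Expands k _ _) (sym (+-identityʳ nG)) eG , addX′ , eQ

Expands-Add-unreplaced : ∀ {k hts hfs w G Q₀ Q₀″ n} → Add (node hts hfs []) w G Q₀ → Expands k Q₀ Q₀″ n →
  Unreplaceable k hfs →
  Σ NSeq λ G″ → Σ NSeq λ X → Add (node hts hfs []) w G″ X × Q₀″ ≈ X × Expands k Q₀ X n
Expands-Add-unreplaced a e unreplaceable with Expands-Add⁻ a e
... | _ , _ , rps , _ , _ , es , _ , n≡ , G″ , X , eG , addX , Q₀″≈X with unreplaceable rps
... | refl with Expands-Add⁻-kept a rps es n≡ eG addX
... | _ , addX′ , eQ = G″ , X , addX′ , Q₀″≈X , eQ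

transpose-∀-premise : ∀ {φ y₁ y₂ w G Q₀ P} →
  Add (fm (all φ)) w G Q₀ → Add (node [ var y₁ ] [ instF (var y₁) φ ] []) w G P →
  ¬ (y₁ ∈ fvSeq Q₀) → ¬ (y₂ ∈ fvSeq Q₀) → Add (node [ var y₂ ] [ instF (var y₂) φ ] []) w G (renSeq (transpose y₁ y₂) P)
transpose-∀-premise {φ} {y₁} {y₂} {w} {G₀} {P = P} a b y₁∉ y₂∉ =
  subst₂ (λ H G′ → Add H w G′ (renSeq (transpose y₁ y₂) P))
    (cong₂ (λ y ψ → node [ var y ] [ ψ ] []) (transpose-a y₁ y₂)
       (≡-trans (renF-instF (transpose y₁ y₂) (var y₁) φ) (cong₂ instF (cong var (transpose-a y₁ y₂)) φ-fixed)))
    (transpose-renSeq-id G₀ (∉-Addˡ a y₁∉) (∉-Addˡ a y₂∉))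
    (renSeq-Add (transpose y₁ y₂) b)
  where
  φ-fixed : renF (transpose y₁ y₂) φ ≡ φ
  φ-fixed = renF-id φ (∉-fvSeq⇒transpose-fixes (fm (all φ)) (∉-Addʳ a y₁∉) (∉-Addʳ a y₂∉) ∘ ∈-++⁺ˡ ∘ ∈-++⁺ˡ)

transpose-nd-premise : ∀ {y₁ y₂ w Q₀ P} → Add (tm (var y₁)) w Q₀ P → ¬ (y₁ ∈ fvSeq Q₀) → ¬ (y₂ ∈ fvSeq Q₀) →
  Add (tm (var y₂)) w Q₀ (renSeq (transpose y₁ y₂) P)
transpose-nd-premise {y₁} {y₂} {w} {Q₀} {P} b y₁∉ y₂∉ =
  subst₂ (λ H G′ → Add H w G′ (renSeq (transpose y₁ y₂) P))
    (cong (λ y → node [ var y ] [] []) (transpose-a y₁ y₂)) (transpose-renSeq-id Q₀ y₁∉ y₂∉)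
    (renSeq-Add (transpose y₁ y₂) b)

transposed-Fresh : ∀ {φ n y y₃} Ps → ¬ (y₃ ∈ concatMap fvSeq Ps) →
  All (FreshFor (invert-∀ φ y) n) (map (renSeq (transpose y y₃)) Ps)
transposed-Fresh [] _ = []
transposed-Fresh {φ} {n} {y} (P ∷ Ps) y₃∉ =
  inj₂ (λ { (here refl) → transpose-removes P (λ y₃∈ → y₃∉ (∈-++⁺ˡ y₃∈)) })
    ∷ transposed-Fresh {φ} {n} {y} Ps (y₃∉ ∘ ∈-++⁺ʳ (fvSeq P))

-- The eigenvariable y of a replaced ∀-formula is fresh for the conclusion but may occur in the premises
-- of its last rule; there it is swapped with a variable fresh for everything, which leaves the
-- conclusion unchanged.
freshen-premises : ∀ {𝒞} k {n Ps Q₀} → FreshFor k n Q₀ → Inst 𝒞 Ps Q₀ → (πs : Proofs 𝒞 Ps) →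
  Σ (List NSeq) λ Ps′ → Inst 𝒞 Ps′ Q₀ × Σ (Proofs 𝒞 Ps′) (λ πs′ → heights πs′ ≡ heights πs) × All (FreshFor k n) Ps′
freshen-premises k {Ps = Ps} (inj₁ n≡0) i πs = Ps , i , (πs , refl) , All.universal (λ _ → inj₁ n≡0) Ps
freshen-premises {𝒞} (invert-∀ φ y) {n} {Ps} {Q₀} (inj₂ y-fresh) i πs =
  map (renSeq τ) Ps ,
  subst (Inst 𝒞 (map (renSeq τ) Ps)) (transpose-renSeq-id Q₀ (y-fresh (here refl)) (fresh-∉ avoid ∘ there ∘ ∈-++⁺ˡ))
    (renSeq-Inst (transpose-injective y y₃) i) ,
  renSeq-Proofs (transpose-injective y y₃) πs ,
  transposed-Fresh {φ} {n} Ps (fresh-∉ avoid ∘ there ∘ ∈-++⁺ʳ (fvSeq Q₀))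
  where
  avoid : List ℕ
  avoid = y ∷ fvSeq Q₀ ++ concatMap fvSeq Ps
  y₃ : ℕ
  y₃ = fresh avoid
  τ : ℕ → ℕ
  τ = transpose y y₃
freshen-premises weakening {Ps = Ps} (inj₂ _) i πs = Ps , i , (πs , refl) , All.universal (λ _ → inj₂ λ ()) Ps
freshen-premises (invert-∨ _ _) {Ps = Ps} (inj₂ _) i πs = Ps , i , (πs , refl) , All.universal (λ _ → inj₂ λ ()) Ps
freshen-premises (invert-∧₁ _ _) {Ps = Ps} (inj₂ _) i πs = Ps , i , (πs , refl) , All.universal (λ _ → inj₂ λ ()) Ps
freshen-premises (invert-∧₂ _ _) {Ps = Ps} (inj₂ _) i πs = Ps , i , (πs , refl) , All.universal (λ _ → inj₂ λ ()) Ps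
freshen-premises (invert-□ _) {Ps = Ps} (inj₂ _) i πs = Ps , i , (πs , refl) , All.universal (λ _ → inj₂ λ ()) Ps

-- Replaying the last rule of a proof on an expansion of its conclusion

Proof≤ : CondSet → NSeq → ℕ → Set
Proof≤ 𝒞 Q b = Σ (Proof 𝒞 Q) λ π → height π ≤ b

weaken-bound : ∀ {𝒞 Q b b′} → b ≤ b′ → Proof≤ 𝒞 Q b → Proof≤ 𝒞 Q b′
weaken-bound b≤b′ (π , π≤b) = π , ≤-trans π≤b b≤b′

replaced-Inversion : ∀ {k H H′ w G G″ P X Q′} → Add H w G P → Add H′ w G″ X →
  Expands k G G″ 0 → Expands k H H′ 0 → Q′ ≈ X → Inversion k P Q′
replaced-Inversion b addX eG eH Q′≈X with Expands-Add b addX refl eG eH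
... | _ , e , X≈P̃ , _ = inversion z≤n e (≈-trans Q′≈X X≈P̃) (inj₁ refl)

data KeptOrReplaced (k : Kind) (φ : Fm) (w : Pos) (G Q″ : NSeq) : ℕ → Set where
  kept : ∀ {n G″ X} → Expands k G G″ n → Add (fm φ) w G″ X → Q″ ≈ X → KeptOrReplaced k φ w G Q″ n
  replaced : ∀ {C C′ G″ X} → Replaces k φ C 1 → Expands k C C′ 0 → Expands k G G″ 0 → Add C′ w G″ X → Q″ ≈ X →
    KeptOrReplaced k φ w G Q″ 1

kept-or-replaced : ∀ {k φ w G Q Q″ n} → n ≤ 1 → Add (fm φ) w G Q → Expands k Q Q″ n → KeptOrReplaced k φ w G Q″ n
kept-or-replaced n≤1 a e with Expands-Add⁻ a e
... | _ , _ , keep ∷ [] , _ , _ , es , _ , n≡ , _ , _ , eG , addX , q with Expands-Add⁻-kept a (keep ∷ []) es n≡ eG addX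
...   | eG′ , addX′ , _ = kept eG′ addX′ q
kept-or-replaced n≤1 a e | _ , _ , replace-∨ ∷ [] , _ , _ , [] , _ , n≡ , _ , _ , eG , addX , q
  with one-replacement n≤1 n≡
... | refl , _ , refl = replaced replace-∨ (Expands-refl _ _) eG addX q
kept-or-replaced n≤1 a e | _ , _ , replace-∧₁ ∷ [] , _ , _ , [] , _ , n≡ , _ , _ , eG , addX , q
  with one-replacement n≤1 n≡
... | refl , _ , refl = replaced replace-∧₁ (Expands-refl _ _) eG addX q
kept-or-replaced n≤1 a e | _ , _ , replace-∧₂ ∷ [] , _ , _ , [] , _ , n≡ , _ , _ , eG , addX , q
  with one-replacement n≤1 n≡
... | refl , _ , refl = replaced replace-∧₂ (Expands-refl _ _) eG addX q
kept-or-replaced n≤1 a e | _ , _ , replace-∀ ∷ [] , _ , _ , [] , _ , n≡ , _ , _ , eG , addX , q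
  with one-replacement n≤1 n≡
... | refl , _ , refl = replaced replace-∀ (Expands-refl _ _) eG addX q
kept-or-replaced {k} n≤1 a e | _ , _ , replace-□ ∷ [] , _ , _ , eφ ∷ [] , _ , n≡ , _ , _ , eG , addX , q
  with one-replacement n≤1 n≡
... | refl , m≡0 , refl =
  replaced replace-□ (subst (Expands k _ _) m≡0 (expands [] refl refl refl (eφ ∷ []) refl)) eG addX q

module Replay {𝒞 : CondSet} (k : Kind) (h : ℕ)
  (IH : ∀ {P P′} (π : Proof 𝒞 P) → height π ≤ h → Inversion k P P′ → Proof≤ 𝒞 P′ (height π)) where

  IH-renamed : ∀ {P P′ ρ} → Injective _≡_ _≡_ ρ → (π : Proof 𝒞 P) → height π ≤ h →
    Inversion k (renSeq ρ P) P′ → Proof≤ 𝒞 P′ (height π)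
  IH-renamed ρ-inj π π≤h inv with renSeq-Proof ρ-inj π
  ... | πρ , h≡ = subst (Proof≤ 𝒞 _) h≡ (IH πρ (subst (_≤ h) (sym h≡) π≤h) inv)

  by-rule : ∀ {Q′ X P b} → Q′ ≈ X → Inst 𝒞 [ P ] X → Proof≤ 𝒞 P b → Proof≤ 𝒞 Q′ (suc (b ⊔ 0))
  by-rule Q′≈X i (π , π≤b) = by Q′≈X i (π ∷ []) , s≤s (⊔-monoˡ-≤ 0 π≤b)

  replay-Add : ∀ {G G″ n u H P X Q′} → n ≤ 1 → Expands k G G″ n → Add H u G P → FreshFor k n P →
    (∀ {P′} → Add H u G″ P′ → Inst 𝒞 [ P′ ] X) → Q′ ≈ X →
    (π : Proof 𝒞 P) → height π ⊔ 0 ≤ h → Proof≤ 𝒞 Q′ (suc (height π ⊔ 0))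
  replay-Add n≤1 e b P-fresh rule Q′≈X π hs with Add-Inversion n≤1 e b P-fresh
  ... | _ , b′ , inv = by-rule Q′≈X (rule b′) (IH π (m⊔n≤o⇒m≤o (height π) 0 hs) inv)

  replay-replaced : ∀ {P Q′} (π : Proof 𝒞 P) → height π ⊔ 0 ≤ h → Inversion k P Q′ →
    Proof≤ 𝒞 Q′ (suc (height π ⊔ 0))
  replay-replaced π hs inv = weaken-bound (≤-trans (m≤m⊔n _ 0) (n≤1+n _)) (IH π (m⊔n≤o⇒m≤o (height π) 0 hs) inv)

  first-≤ : ∀ {P₁ P₂} (π₁ : Proof 𝒞 P₁) (π₂ : Proof 𝒞 P₂) → height π₁ ⊔ (height π₂ ⊔ 0) ≤ h → height π₁ ≤ h
  first-≤ π₁ π₂ = m⊔n≤o⇒m≤o (height π₁) _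

  second-≤ : ∀ {P₁ P₂} (π₁ : Proof 𝒞 P₁) (π₂ : Proof 𝒞 P₂) → height π₁ ⊔ (height π₂ ⊔ 0) ≤ h → height π₂ ≤ h
  second-≤ π₁ π₂ = m⊔n≤o⇒m≤o (height π₂) 0 ∘ m⊔n≤o⇒n≤o (height π₁) _

  newEigen : NSeq → NSeq → ℕ
  newEigen X Q₀ = fresh (eigenvariables k ++ fvSeq X ++ fvSeq Q₀)

  newEigen-∉ : ∀ X Q₀ →
    ¬ (newEigen X Q₀ ∈ eigenvariables k) × ¬ (newEigen X Q₀ ∈ fvSeq X) × ¬ (newEigen X Q₀ ∈ fvSeq Q₀)
  newEigen-∉ X Q₀ =
    fresh-∉ avoid ∘ ∈-++⁺ˡ ,
    fresh-∉ avoid ∘ ∈-++⁺ʳ (eigenvariables k) ∘ ∈-++⁺ˡ ,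
    fresh-∉ avoid ∘ ∈-++⁺ʳ (eigenvariables k) ∘ ∈-++⁺ʳ (fvSeq X)
    where
    avoid : List ℕ
    avoid = eigenvariables k ++ fvSeq X ++ fvSeq Q₀

  Replays : List NSeq → NSeq → Set
  Replays Ps Q₀ = ∀ {Q₀″ Q′ n} → n ≤ 1 → Expands k Q₀ Q₀″ n → Q′ ≈ Q₀″ → FreshFor k n Q₀ →
    (πs : Proofs 𝒞 Ps) → heights πs ≤ h → All (FreshFor k n) Ps → Proof≤ 𝒞 Q′ (suc (heights πs))

  replay-weakened : ∀ {H u Q₀ P} → Add H u Q₀ P →
    (∀ {n X P′} → Expands k Q₀ X n → Add H u X P′ → Inst 𝒞 [ P′ ] X) → Replays [ P ] Q₀
  replay-weakened b rule n≤1 e₀ q₀ _ (π ∷ []) hs (f ∷ []) = replay-Add n≤1 e₀ b f (rule e₀) q₀ π hs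

  replay-kept : ∀ {hts hfs w G Q₀ H u P} → Add (node hts hfs []) w G Q₀ → Unreplaceable k hfs → Add H u Q₀ P →
    (∀ {n G″ X P′} → Expands k Q₀ X n → Add (node hts hfs []) w G″ X → Add H u X P′ → Inst 𝒞 [ P′ ] X) →
    Replays [ P ] Q₀
  replay-kept a unreplaceable b rule n≤1 e₀ q₀ _ (π ∷ []) hs (f ∷ [])
    with Expands-Add-unreplaced a e₀ unreplaceable
  ... | _ , _ , addX , q₁ , eQ = replay-Add n≤1 eQ b f (rule eQ addX) (≈-trans q₀ q₁) π hs

  replay-∧ : ∀ {φ ψ w G Q₀ P₁ P₂} → Add (fm (and φ ψ)) w G Q₀ → Add (fm φ) w G P₁ → Add (fm ψ) w G P₂ →
    Replays (P₁ ∷ P₂ ∷ []) Q₀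
  replay-∧ a b c n≤1 e₀ q₀ _ (π₁ ∷ π₂ ∷ []) hs (f₁ ∷ f₂ ∷ []) with kept-or-replaced n≤1 a e₀
  ... | kept eG addX q₁ with Add-Inversion n≤1 eG b f₁ | Add-Inversion n≤1 eG c f₂
  ... | _ , b′ , inv₁ | _ , c′ , inv₂ with IH π₁ (first-≤ π₁ π₂ hs) inv₁ | IH π₂ (second-≤ π₁ π₂ hs) inv₂
  ... | π₁′ , π₁′≤ | π₂′ , π₂′≤ =
    by (≈-trans q₀ q₁) (∧r addX b′ c′) (π₁′ ∷ π₂′ ∷ []) , s≤s (⊔-mono-≤ π₁′≤ (⊔-monoˡ-≤ 0 π₂′≤))
  replay-∧ a b c n≤1 e₀ q₀ _ (π₁ ∷ π₂ ∷ []) hs _ | replaced replace-∧₁ eC eG addX q₁ =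
    weaken-bound (≤-trans (m≤m⊔n _ _) (n≤1+n _))
      (IH π₁ (first-≤ π₁ π₂ hs) (replaced-Inversion b addX eG eC (≈-trans q₀ q₁)))
  replay-∧ a b c n≤1 e₀ q₀ _ (π₁ ∷ π₂ ∷ []) hs _ | replaced replace-∧₂ eC eG addX q₁ =
    weaken-bound (≤-trans (m≤m⊔n _ 0) (≤-trans (m≤n⊔m (height π₁) _) (n≤1+n _)))
      (IH π₂ (second-≤ π₁ π₂ hs) (replaced-Inversion c addX eG eC (≈-trans q₀ q₁)))

  -- The eigenvariable y₁ may occur in the added material, so it is swapped with one that does not.
  replay-∀ : ∀ {φ y₁ w G Q₀ P} → Add (fm (all φ)) w G Q₀ → Add (node [ var y₁ ] [ instF (var y₁) φ ] []) w G P →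
    ¬ (y₁ ∈ fvSeq Q₀) → Replays [ P ] Q₀
  replay-∀ {y₁ = y₁} {Q₀ = Q₀} {P} a b y₁∉ n≤1 e₀ q₀ _ (π ∷ []) hs (f ∷ []) with kept-or-replaced n≤1 a e₀
  ... | kept {X = X} eG addX q₁ with newEigen-∉ X Q₀
  ... | y∉k , y∉X , y∉Q₀
    with Add-Inversion n≤1 eG (transpose-∀-premise a b y₁∉ y∉Q₀)
           (map₂ (Fresh-transpose {k} {P = P} y∉k (∈-Addʳ b (here refl))) f)
  ... | _ , b′ , inv =
    by-rule (≈-trans q₀ q₁) (∀r addX b′ y∉X) (IH-renamed (transpose-injective y₁ _) π (m⊔n≤o⇒m≤o (height π) 0 hs) inv)
  replay-∀ {y₁ = y₁} a b y₁∉ n≤1 e₀ q₀ (inj₂ y-fresh) (π ∷ []) hs _ | replaced replace-∀ eC eG addX q₁ =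
    weaken-bound (≤-trans (m≤m⊔n _ 0) (n≤1+n _))
      (IH-renamed (transpose-injective y₁ _) π (m⊔n≤o⇒m≤o (height π) 0 hs)
        (replaced-Inversion (transpose-∀-premise a b y₁∉ (y-fresh (here refl))) addX eG eC (≈-trans q₀ q₁)))

  replay-nd : ∀ {y₁ w Q₀ P} → 𝒞 NE → Add (tm (var y₁)) w Q₀ P → ¬ (y₁ ∈ fvSeq Q₀) → Replays [ P ] Q₀
  replay-nd {y₁} {Q₀ = Q₀} {P} NE∈𝒞 b y₁∉ {Q₀″} n≤1 e₀ q₀ _ (π ∷ []) hs (f ∷ []) with newEigen-∉ Q₀″ Q₀
  ... | y∉k , y∉Q₀″ , y∉Q₀
    with Add-Inversion n≤1 e₀ (transpose-nd-premise b y₁∉ y∉Q₀)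
           (map₂ (Fresh-transpose {k} {P = P} y∉k (∈-Addʳ b (here refl))) f)
  ... | _ , b′ , inv =
    by-rule q₀ (nd NE∈𝒞 b′ y∉Q₀″) (IH-renamed (transpose-injective y₁ _) π (m⊔n≤o⇒m≤o (height π) 0 hs) inv)

  replay : ∀ {Ps Q₀} → Inst 𝒞 Ps Q₀ → Replays Ps Q₀
  replay (ax lit a) n≤1 e₀ q₀ _ [] _ []
    with Expands-Add-unreplaced a e₀ (literals-unreplaceable (lit ∷ ‾-IsLiteral lit ∷ []))
  ... | _ , _ , addX , q₁ , _ = by (≈-trans q₀ q₁) (ax lit addX) [] , s≤s z≤n
  replay (∨r a b) n≤1 e₀ q₀ _ (π ∷ []) hs (f ∷ []) with kept-or-replaced n≤1 a e₀
  ... | kept eG addX q₁ = replay-Add n≤1 eG b f (∨r addX) (≈-trans q₀ q₁) π hs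
  ... | replaced replace-∨ eC eG addX q₁ = replay-replaced π hs (replaced-Inversion b addX eG eC (≈-trans q₀ q₁))
  replay (∧r a b c) = replay-∧ a b c
  replay (∃r a b) = replay-kept a (λ { (keep ∷ []) → refl }) b (λ _ addX → ∃r addX)
  replay (∀r a b y∉) = replay-∀ a b y∉
  replay (◇r a b pth) = replay-kept a (λ { (keep ∷ []) → refl }) b (λ eQ addX b′ → ◇r addX b′ (Expands-PathL eQ pth))
  replay (□r a b) n≤1 e₀ q₀ _ (π ∷ []) hs (f ∷ []) with kept-or-replaced n≤1 a e₀
  ... | kept eG addX q₁ = replay-Add n≤1 eG b f (□r addX) (≈-trans q₀ q₁) π hs
  ... | replaced replace-□ eC eG addX q₁ = replay-replaced π hs (replaced-Inversion b addX eG eC (≈-trans q₀ q₁))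
  replay (ref b) = replay-weakened b (λ _ → ref)
  replay (rep N-neg a b) =
    replay-kept a (literals-unreplaceable (lit-neq ∷ substF-IsLiteral N-neg ∷ [])) b (λ _ addX → rep N-neg addX)
  replay (drep a b) = replay-kept a (λ { (keep ∷ []) → refl }) b (λ _ addX → drep addX)
  replay (rig a b w≢u) = replay-kept a (λ { (keep ∷ []) → refl }) b (λ _ addX b′ → rig addX b′ w≢u)
  replay (dp-ID ID∈𝒞 DD∉𝒞 a b w≢u pth) =
    replay-kept a (λ { [] → refl }) b (λ eQ addX b′ → dp-ID ID∈𝒞 DD∉𝒞 addX b′ w≢u (Expands-PathL eQ pth))
  replay (dp-DD DD∈𝒞 ID∉𝒞 a b w≢u pth) =
    replay-kept a (λ { [] → refl }) b (λ eQ addX b′ → dp-DD DD∈𝒞 ID∉𝒞 addX b′ w≢u (Expands-PathL eQ pth))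
  replay (dp-both ID∈𝒞 DD∈𝒞 a b w≢u pth) =
    replay-kept a (λ { [] → refl }) b (λ eQ addX b′ → dp-both ID∈𝒞 DD∈𝒞 addX b′ w≢u (Expands-PathL eQ pth))
  replay (d D∈𝒞 b) = replay-weakened b (λ _ → d D∈𝒞)
  replay (nd NE∈𝒞 b y∉) = replay-nd NE∈𝒞 b y∉
  replay (cd CD∈𝒞 b) = replay-weakened b (λ _ → cd CD∈𝒞)

hp-inversion : ∀ {𝒞} k h {Q Q′} (π : Proof 𝒞 Q) → height π ≤ h → Inversion k Q Q′ → Proof≤ 𝒞 Q′ (height π)
hp-inversion k zero (by _ _ _) () _
hp-inversion {𝒞} k (suc h) {Q′ = Q′} (by {𝒬′ = Q₀} Q≈Q₀ i πs) (s≤s πs≤h) (inversion n≤1 e Q′≈Q″ Q-fresh)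
  with Expands-≈ Q≈Q₀ e | map₂ (Fresh-≈ {k} {B = Q₀} Q≈Q₀) Q-fresh
... | _ , e₀ , Q″≈Q₀″ | Q₀-fresh with freshen-premises k Q₀-fresh i πs
... | _ , i′ , (πs′ , h≡) , Ps-fresh =
  subst (λ b → Proof≤ 𝒞 Q′ (suc b)) h≡
    (Replay.replay k h (hp-inversion k h) i′ n≤1 e₀ (≈-trans Q′≈Q″ Q″≈Q₀″) Q₀-fresh
       πs′ (subst (_≤ h) (sym h≡) πs≤h) Ps-fresh)

Add-empty-≈ : ∀ {u A A₀} → Add (node [] [] []) u A A₀ → A₀ ≈ A
Add-empty-≈ (here {ts} {fs} {cs} refl) =
  ≈node-Pointwise (↭-reflexive (++-identityʳ ts)) (↭-reflexive (++-identityʳ fs)) (Pointwise-≈-refl (cs ++ []))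
    (↭-reflexive (++-identityʳ cs))
Add-empty-≈ (there {l = l} {r = r} a) =
  ≈node-Pointwise ↭-refl ↭-refl (Pointwise.++⁺ (Pointwise-≈-refl l) (Add-empty-≈ a ∷ Pointwise-≈-refl r)) ↭-refl

empty-Expands : ∀ {k} H → Expands k (node [] [] []) H 0
empty-Expands (node ts fs cs) = expands [] ↭-refl ↭-refl ↭-refl [] refl

weakening-Inversion : ∀ {k H u A P} → Add H u A P → Inversion k A P
weakening-Inversion {k} {H} {u} {A} b with IsPos⇒Add (node [] [] []) (Add-IsPos b)
... | A₀ , a₀ with Expands-Add a₀ b refl (Expands-refl k A) (empty-Expands H)
... | _ , e , P≈P̃ , _ with Expands-≈ (Add-empty-≈ a₀) e
... | _ , e′ , P̃≈P̃′ = inversion z≤n e′ (≈-trans P≈P̃ P̃≈P̃′) (inj₁ refl)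

Replaces⇒Expands : ∀ {k φ C} → Replaces k φ C 1 → Expands k (fm φ) C 1
Replaces⇒Expands replace-∨ = expands (replace-∨ ∷ []) refl refl refl [] refl
Replaces⇒Expands replace-∧₁ = expands (replace-∧₁ ∷ []) refl refl refl [] refl
Replaces⇒Expands replace-∧₂ = expands (replace-∧₂ ∷ []) refl refl refl [] refl
Replaces⇒Expands replace-∀ = expands (replace-∀ ∷ []) refl refl refl [] refl
Replaces⇒Expands {k} {box φ} replace-□ = expands (replace-□ ∷ []) refl refl refl (Expands-refl k (fm φ) ∷ []) refl

replacement-Inversion : ∀ {k φ C w G Q P} → Add (fm φ) w G Q → Add C w G P → Replaces k φ C 1 → Fresh k Q →
  Inversion k Q P
replacement-Inversion {k} {G = G₀} a b r Q-fresh with Expands-Add a b refl (Expands-refl k G₀) (Replaces⇒Expands r)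
... | _ , e , P≈P̃ , _ = inversion ≤-refl e P≈P̃ (inj₂ Q-fresh)

premise-Inversion : ∀ {𝒞 Ps Q P} → Inst 𝒞 Ps Q → P ∈ Ps → Σ Kind λ k → Inversion k Q P
premise-Inversion (∨r a b) (here refl) = _ , replacement-Inversion a b replace-∨ λ ()
premise-Inversion (∧r a b c) (here refl) = _ , replacement-Inversion a b replace-∧₁ λ ()
premise-Inversion (∧r a b c) (there (here refl)) = _ , replacement-Inversion a c replace-∧₂ λ ()
premise-Inversion (∀r a b y∉) (here refl) = _ , replacement-Inversion a b replace-∀ λ { (here refl) → y∉ }
premise-Inversion (□r a b) (here refl) = _ , replacement-Inversion a b replace-□ λ ()
premise-Inversion (∃r a b) (here refl) = weakening , weakening-Inversion b
premise-Inversion (◇r a b _) (here refl) = weakening , weakening-Inversion b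
premise-Inversion (ref b) (here refl) = weakening , weakening-Inversion b
premise-Inversion (rep _ a b) (here refl) = weakening , weakening-Inversion b
premise-Inversion (drep a b) (here refl) = weakening , weakening-Inversion b
premise-Inversion (rig a b _) (here refl) = weakening , weakening-Inversion b
premise-Inversion (dp-ID _ _ a b _ _) (here refl) = weakening , weakening-Inversion b
premise-Inversion (dp-DD _ _ a b _ _) (here refl) = weakening , weakening-Inversion b
premise-Inversion (dp-both _ _ a b _ _) (here refl) = weakening , weakening-Inversion b
premise-Inversion (d _ b) (here refl) = weakening , weakening-Inversion b
premise-Inversion (nd _ b _) (here refl) = weakening , weakening-Inversion b
premise-Inversion (cd _ b) (here refl) = weakening , weakening-Inversion b

mainTheorem8 : (𝒞 : CondSet) → Closed 𝒞 →
    ∀ {Ps 𝒬} → Inst 𝒞 Ps 𝒬 → ∀ {𝒫} → 𝒫 ∈ Ps →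
    (π : Proof 𝒞 𝒬) → Σ (Proof 𝒞 𝒫) (λ π′ → height π′ ≤ height π)
mainTheorem8 𝒞 _ i 𝒫∈Ps π with premise-Inversion i 𝒫∈Ps
... | k , inv = hp-inversion k (height π) π ≤-refl inv
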